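{- For all $n\ge1$, $\operatorname{tr}R^{(W(n))}=1$.
   Context: A 4-tuple $(x,y,a,b)$ is an edge from peg $x$ at height $a$ to peg $y$ at height $b$ (height 1 = bottom). $W(n)$ is the set (a web world) of web diagrams on $n+2$ pegs $D=\{(i,i+1,x_i,y_{i+1}):1\le i\le n+1\}$ with $x_1=y_{n+2}=1$ and $\{x_i,y_i\}=\{1,2\}$ for $2\le i\le n+1$ (a chain of $n+1$ edges between consecutive pegs, with the two endpoints on each inner peg in either order). Reconstruction: $D\oplus D'=D\cup\{(x',y',a'+p_{x'}(D),b'+p_{y'}(D)):(x',y',a',b')\in D'\}$, $p_i(D)$ the number of endpoints of $D$ on peg $i$; $\mathrm{rel}(X)$ relabels heights of endpoints of edges of $X$ on each peg by $1,\dots,\ell_i$ preserving relative order; an $\ell$-colouring of $D$ is a surjection $c$ from its edges onto $\{1,\dots,\ell\}$, and $\mathcal{R}(D,c)=\mathrm{rel}(D_c(1))\oplus\cdots\oplus\mathrm{rel}(D_c(\ell))$ with $D_c(t)$ the edges of colour $t$. $f(D_1,D_2,\ell)$ is the number of $\ell$-colourings $c$ of $D_1$ with $\mathcal{R}(D_1,c)=D_2$; the web-mixing matrix $R^{(W)}$ is indexed by $W\times W$ with $R^{(W)}_{D_1,D_2}=\sum_{\ell\ge1}\frac{(-1)^{\ell-1}}{\ell}f(D_1,D_2,\ell)$. -}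

module Defs where

open import Data.Bool using (Bool; true; false; _∧_; _∨_; if_then_else_; not)
open import Data.Nat using (ℕ; zero; suc; _+_; _∸_; _≡ᵇ_; _<ᵇ_)
open import Data.Fin using (Fin; toℕ)
open import Data.Fin.Properties using () renaming (_≟_ to _≟ᶠ_)
open import Data.Product using (_×_; _,_)
open import Data.List using (List; []; _∷_; _++_; map; length; filter; foldl; foldr; concatMap; allFin; zip; upTo; applyUpTo; filterᵇ)
open import Data.Bool.ListAction using (all; any)
open import Data.Vec using (Vec; []; _∷_; toList; tabulate)
open import Data.Integer using (ℤ; +_; -[1+_])
open import Data.Rational using (ℚ; 0ℚ; _+_; _*_; _/_)
open import Relation.Nullary.Decidable using (⌊_⌋)

-- Web diagrams as finite sets of edges, represented by lists.
-- An edge (x , y , a , b) goes from peg x at height a to peg y at height b.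

Edge : Set
Edge = ℕ × ℕ × ℕ × ℕ

Diagram : Set
Diagram = List Edge

_==ᴱ_ : Edge → Edge → Bool
(x , y , a , b) ==ᴱ (x' , y' , a' , b') =
  (x ≡ᵇ x') ∧ (y ≡ᵇ y') ∧ (a ≡ᵇ a') ∧ (b ≡ᵇ b')

_∈ᵇ_ : Edge → Diagram → Bool
e ∈ᵇ D = any (e ==ᴱ_) D

_≈ᵇ_ : Diagram → Diagram → Bool
D ≈ᵇ D' = all (_∈ᵇ D') D ∧ all (_∈ᵇ D) D'

count : {A : Set} → (A → Bool) → List A → ℕ
count p xs = length (filterᵇ p xs)

pegCount : ℕ → Diagram → ℕ
pegCount i [] = 0
pegCount i ((x , y , a , b) ∷ D) =
  (if x ≡ᵇ i then 1 else 0) Data.Nat.+ (if y ≡ᵇ i then 1 else 0) Data.Nat.+ pegCount i D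

below : ℕ → ℕ → Diagram → ℕ
below i h [] = 0
below i h ((x , y , a , b) ∷ X) =
  (if (x ≡ᵇ i) ∧ (a <ᵇ h) then 1 else 0) Data.Nat.+
  (if (y ≡ᵇ i) ∧ (b <ᵇ h) then 1 else 0) Data.Nat.+ below i h X

-- rel(X): relabel heights on each peg by 1,…,ℓ_i preserving relative order
rel : Diagram → Diagram
rel X = map (λ { (x , y , a , b) → (x , y , suc (below x a X) , suc (below y b X)) }) X

_⊕_ : Diagram → Diagram → Diagram
D ⊕ D' = D ++ map (λ { (x , y , a , b) → (x , y , a Data.Nat.+ pegCount x D , b Data.Nat.+ pegCount y D) }) D'

-- Colourings.  A colouring of a diagram given as a list of m edges is a
-- vector of m colours in Fin ℓ (colour t ∈ Fin ℓ stands for t+1).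

allVecs : (ℓ m : ℕ) → List (Vec (Fin ℓ) m)
allVecs ℓ zero = [] ∷ []
allVecs ℓ (suc m) = concatMap (λ t → map (t ∷_) (allVecs ℓ m)) (allFin ℓ)

isSurjective : {ℓ m : ℕ} → Vec (Fin ℓ) m → Bool
isSurjective {ℓ} c = all (λ t → any (λ s → ⌊ s ≟ᶠ t ⌋) (toList c)) (allFin ℓ)

colourClass : {ℓ : ℕ} → (D : Diagram) → Vec (Fin ℓ) (length D) → Fin ℓ → Diagram
colourClass D c t =
  map (λ { (e , s) → e }) (filterᵇ (λ { (e , s) → ⌊ s ≟ᶠ t ⌋ }) (zip D (toList c)))

reconstruct : {ℓ : ℕ} → (D : Diagram) → Vec (Fin ℓ) (length D) → Diagram
reconstruct {ℓ} D c = foldl (λ acc t → acc ⊕ rel (colourClass D c t)) [] (allFin ℓ)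

f : Diagram → Diagram → ℕ → ℕ
f D₁ D₂ ℓ = count (λ c → isSurjective c ∧ (reconstruct D₁ c ≈ᵇ D₂)) (allVecs ℓ (length D₁))

-- Web-mixing matrix entry: Σ_{ℓ ≥ 1} (-1)^{ℓ-1}/ℓ · f(D₁,D₂,ℓ).
-- For ℓ > |D₁| there is no surjective ℓ-colouring, so f = 0 and the sum
-- is the finite sum over 1 ≤ ℓ ≤ |D₁|.

sign : ℕ → ℤ
sign zero = + 1
sign (suc zero) = -[1+ 0 ]
sign (suc (suc k)) = sign k

sumℚ : List ℚ → ℚ
sumℚ = foldr Data.Rational._+_ 0ℚ

term : Diagram → Diagram → ℕ → ℚ      -- term for ℓ = suc k
term D₁ D₂ k = (sign k / suc k) Data.Rational.* (+ f D₁ D₂ (suc k) / 1)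

R : Diagram → Diagram → ℚ
R D₁ D₂ = sumℚ (map (term D₁ D₂) (upTo (length D₁)))

-- The web world W(n): n+2 pegs, edges (i,i+1,x_i,y_{i+1}) for 1 ≤ i ≤ n+1,
-- x_1 = y_{n+2} = 1, and {x_j,y_j} = {1,2} on each inner peg 2 ≤ j ≤ n+1.
-- A choice s : Vec Bool n records for inner peg j = k+2 (k : Fin n)
-- whether (x_j , y_j) = (2 , 1) (true) or (1 , 2) (false).

lookupB : {n : ℕ} → Vec Bool n → ℕ → Bool   -- s at position k (false if out of range)
lookupB [] k = false
lookupB (b ∷ s) zero = b
lookupB (b ∷ s) (suc k) = lookupB s k

-- x_j and y_j for peg j (1-based) given the choice s
xPeg : {n : ℕ} → Vec Bool n → ℕ → ℕ
xPeg s 0 = 1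
xPeg s 1 = 1
xPeg s (suc (suc k)) = if lookupB s k then 2 else 1

yPeg : {n : ℕ} → Vec Bool n → ℕ → ℕ
yPeg {n} s j = if j ≡ᵇ (n Data.Nat.+ 2) then 1 else (if lookupB s (j ∸ 2) then 1 else 2)

webDiagram : {n : ℕ} → Vec Bool n → Diagram
webDiagram {n} s = applyUpTo (λ k → (suc k , suc (suc k) , xPeg s (suc k) , yPeg s (suc (suc k)))) (suc n)

allBoolVecs : (n : ℕ) → List (Vec Bool n)
allBoolVecs zero = [] ∷ []
allBoolVecs (suc n) = concatMap (λ b → map (b ∷_) (allBoolVecs n)) (true ∷ false ∷ [])

-- W(n), listed without repetition
W : ℕ → List Diagram
W n = map webDiagram (allBoolVecs n)

traceR : ℕ → ℚ
traceR n = sumℚ (map (λ D → R D D) (W n))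

module Submission where

open import Defs
open import Data.Nat using (ℕ; _≥_)
open import Data.Rational using (1ℚ)
open import Relation.Binary.PropositionalEquality using (_≡_)

-- Write the diagram of W(n) with choice vector s as the chain E₀,…,E_n,
-- and a colouring as the sequence u₀,…,u_n of its edge colours.
--  (1) For an arbitrary diagram D and colouring c, the reconstruction
--      R(D,c) contains exactly the edges of D with their heights moved to
--      1 + (same-coloured endpoints below on that peg)
--        + (endpoints of smaller colour on that peg).
--  (2) On a chain each inner peg carries two endpoints, so R(D_s,c) = D_s
--      iff each consecutive pair of colours satisfies one local inequality
--      dictated by s.  Summing over s, every colouring u is counted
--      weight u = ∏ⱼ (2 if uⱼ = uⱼ₊₁ else 1) times.
--  (3) The total weight h(m,ℓ) of surjective ℓ-colourings of an (m+1)-chain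
--      satisfies h(m+1,ℓ+1) = (ℓ+2)·h(m,ℓ+1) + (ℓ+1)·h(m,ℓ), obtained by
--      splitting off the colour of the first edge.
--  (4) Hence tr R = Σ_ℓ (-1)^(ℓ-1)/ℓ · h(n,ℓ), and by the recurrence this
--      alternating sum does not change from m to m+1 (the excess telescopes),
--      so it equals its value 1 at m = 0.
-- General lemmas on finite sums, boolean tests and diagrams as edge sets
-- come first; the four steps follow in order, and the theorem combines
-- the last two.

open import Data.Bool using (Bool; true; false; _∧_; _∨_; if_then_else_; not; T)
open import Data.Bool.Properties using (∨-assoc; ∨-zeroʳ; ∧-distribʳ-∨; ∨-commutativeMonoid)
open import Data.Bool.ListAction using (all; any)
open import Data.Nat using (zero; suc; _+_; _*_; _≡ᵇ_; _<ᵇ_; _<_; z≤n; s≤s)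
open import Data.Nat.Properties
  using (+-identityʳ; +-assoc; +-comm; +-suc; *-zeroʳ; *-comm; *-identityʳ; *-distribˡ-+;
         ≡ᵇ⇒≡; <-irrefl; ≤-pred; m<n⇒m<1+n; m<1+n⇒m<n∨m≡n; n<1+n; suc-injective;
         +-commutativeSemigroup)
open import Data.Fin using (Fin; toℕ; punchIn; punchOut) renaming (zero to fzero; suc to fsuc)
open import Data.Fin.Properties
  using (toℕ-injective; toℕ<n; punchIn-injective; punchInᵢ≢i; punchIn-punchOut)
  renaming (_≟_ to _≟ᶠ_)
open import Data.Product using (Σ; _×_; _,_; proj₁; proj₂)
open import Data.Sum using (_⊎_; inj₁; inj₂)
open import Data.List using (List; []; _∷_; _++_; map; length; filterᵇ; foldl; zip; tabulate; upTo;
                             allFin; applyUpTo; concatMap)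
open import Data.List.Properties using (length-applyUpTo; length-tabulate)
open import Data.Vec using (Vec; toList) renaming ([] to []ᵛ; _∷_ to _∷ᵛ_)
import Data.Vec as Vec
open import Data.Unit using (⊤; tt)
open import Data.Empty using (⊥; ⊥-elim)
open import Relation.Nullary using (yes; no; ¬_)
open import Relation.Nullary.Decidable using (⌊_⌋)
open import Relation.Binary.PropositionalEquality
  using (refl; sym; trans; cong; cong₂; subst; module ≡-Reasoning)
open import Algebra.Properties.CommutativeSemigroup +-commutativeSemigroup
  using () renaming (interchange to +-interchange)
open import Algebra.Bundles using (CommutativeMonoid)
open import Algebra.Properties.CommutativeSemigroup (CommutativeMonoid.commutativeSemigroup ∨-commutativeMonoid)
  using () renaming (interchange to ∨-interchange)

infixr 7 [_]·_
[_]·_ : Bool → ℕ → ℕ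
[ b ]· x = if b then x else 0

sumL : {A : Set} → (A → ℕ) → List A → ℕ
sumL g [] = 0
sumL g (x ∷ xs) = g x + sumL g xs

module _ {A : Set} where

  sumL-cong : {g h : A → ℕ} (xs : List A) → (∀ x → g x ≡ h x) → sumL g xs ≡ sumL h xs
  sumL-cong [] eq = refl
  sumL-cong (x ∷ xs) eq = cong₂ _+_ (eq x) (sumL-cong xs eq)

  sumL-+ : (g h : A → ℕ) (xs : List A) → sumL (λ x → g x + h x) xs ≡ sumL g xs + sumL h xs
  sumL-+ g h [] = refl
  sumL-+ g h (x ∷ xs) =
    trans (cong (g x + h x +_) (sumL-+ g h xs)) (+-interchange (g x) (h x) (sumL g xs) (sumL h xs))

  sumL-++ : (g : A → ℕ) (xs ys : List A) → sumL g (xs ++ ys) ≡ sumL g xs + sumL g ys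
  sumL-++ g [] ys = refl
  sumL-++ g (x ∷ xs) ys = trans (cong (g x +_) (sumL-++ g xs ys)) (sym (+-assoc (g x) _ _))

  sumL-zero : (xs : List A) → sumL (λ _ → 0) xs ≡ 0
  sumL-zero [] = refl
  sumL-zero (x ∷ xs) = sumL-zero xs

  sumL-*ˡ : (g : A → ℕ) (w : ℕ) (xs : List A) → sumL (λ x → w * g x) xs ≡ w * sumL g xs
  sumL-*ˡ g w [] = sym (*-zeroʳ w)
  sumL-*ˡ g w (x ∷ xs) = trans (cong (w * g x +_) (sumL-*ˡ g w xs)) (sym (*-distribˡ-+ w (g x) _))

  sumL-guard : (b : Bool) (q : A → Bool) (xs : List A) →
    sumL (λ x → [ b ∧ q x ]· 1) xs ≡ ([ b ]· sumL (λ x → [ q x ]· 1) xs)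
  sumL-guard true q xs = refl
  sumL-guard false q xs = sumL-zero xs

  count≡sumL : (p : A → Bool) (xs : List A) → count p xs ≡ sumL (λ x → [ p x ]· 1) xs
  count≡sumL p [] = refl
  count≡sumL p (x ∷ xs) with p x
  ... | true = cong suc (count≡sumL p xs)
  ... | false = count≡sumL p xs

module _ {A B : Set} where

  sumL-map : (g : B → ℕ) (f : A → B) (xs : List A) → sumL g (map f xs) ≡ sumL (λ x → g (f x)) xs
  sumL-map g f [] = refl
  sumL-map g f (x ∷ xs) = cong (g (f x) +_) (sumL-map g f xs)

  sumL-concatMap : (g : B → ℕ) (f : A → List B) (xs : List A) →
    sumL g (concatMap f xs) ≡ sumL (λ x → sumL g (f x)) xs
  sumL-concatMap g f [] = refl
  sumL-concatMap g f (x ∷ xs) =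
    trans (sumL-++ g (f x) (concatMap f xs)) (cong (sumL g (f x) +_) (sumL-concatMap g f xs))

  sumL-swap : (g : A → B → ℕ) (xs : List A) (ys : List B) →
    sumL (λ x → sumL (g x) ys) xs ≡ sumL (λ y → sumL (λ x → g x y) xs) ys
  sumL-swap g [] ys = sym (sumL-zero ys)
  sumL-swap g (x ∷ xs) ys =
    trans (cong (sumL (g x) ys +_) (sumL-swap g xs ys)) (sym (sumL-+ (g x) (λ y → sumL (λ x → g x y) xs) ys))

sumFin : ∀ n → (Fin n → ℕ) → ℕ
sumFin zero g = 0
sumFin (suc n) g = g fzero + sumFin n (λ i → g (fsuc i))

sumFin-cong : ∀ n {g h : Fin n → ℕ} → (∀ i → g i ≡ h i) → sumFin n g ≡ sumFin n h
sumFin-cong zero e = refl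
sumFin-cong (suc n) e = cong₂ _+_ (e fzero) (sumFin-cong n (λ i → e (fsuc i)))

sumFin-const : ∀ n a → sumFin n (λ _ → a) ≡ n * a
sumFin-const zero a = refl
sumFin-const (suc n) a = cong (a +_) (sumFin-const n a)

sumFin-zero : ∀ n (g : Fin n → ℕ) → (∀ i → g i ≡ 0) → sumFin n g ≡ 0
sumFin-zero n g h = trans (sumFin-cong n h) (trans (sumFin-const n 0) (*-zeroʳ n))

sumL-allFin : ∀ {n} (g : Fin n → ℕ) → sumL g (allFin n) ≡ sumFin n g
sumL-allFin g = go _ g (λ i → i)
  where
  go : ∀ {k} n (g : Fin k → ℕ) (h : Fin n → Fin k) → sumL g (tabulate h) ≡ sumFin n (λ i → g (h i))
  go zero g h = refl
  go (suc n) g h = cong (g (h fzero) +_) (go n g (λ i → h (fsuc i)))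

sumFin-+ : ∀ n (g h : Fin n → ℕ) → sumFin n (λ i → g i + h i) ≡ sumFin n g + sumFin n h
sumFin-+ n g h =
  trans (sym (sumL-allFin (λ i → g i + h i)))
        (trans (sumL-+ g h (allFin n)) (cong₂ _+_ (sumL-allFin g) (sumL-allFin h)))

sumTo : ℕ → (ℕ → ℕ) → ℕ
sumTo zero g = 0
sumTo (suc m) g = g 0 + sumTo m (λ i → g (suc i))

sumTo-cong : ∀ m {g h : ℕ → ℕ} → (∀ i → g i ≡ h i) → sumTo m g ≡ sumTo m h
sumTo-cong zero e = refl
sumTo-cong (suc m) e = cong₂ _+_ (e 0) (sumTo-cong m (λ i → e (suc i)))

sumTo-+ : ∀ m (g h : ℕ → ℕ) → sumTo m (λ i → g i + h i) ≡ sumTo m g + sumTo m h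
sumTo-+ zero g h = refl
sumTo-+ (suc m) g h =
  trans (cong (g 0 + h 0 +_) (sumTo-+ m (λ i → g (suc i)) (λ i → h (suc i))))
        (+-interchange (g 0) (h 0) _ _)

[]·-zero : ∀ b → [ b ]· 0 ≡ 0
[]·-zero true = refl
[]·-zero false = refl

sumTo-point : ∀ m p (β : ℕ → ℕ) → sumTo m (λ i → [ i ≡ᵇ p ]· β i) ≡ [ p <ᵇ m ]· β p
sumTo-point zero p β = refl
sumTo-point (suc m) zero β = trans (cong (β 0 +_) (sumTo-zero m)) (+-identityʳ (β 0))
  where
  sumTo-zero : ∀ m → sumTo m (λ _ → 0) ≡ 0
  sumTo-zero zero = refl
  sumTo-zero (suc m) = sumTo-zero m
sumTo-point (suc m) (suc p) β = sumTo-point m p (λ i → β (suc i))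

≡ᵇ-refl : ∀ m → (m ≡ᵇ m) ≡ true
≡ᵇ-refl zero = refl
≡ᵇ-refl (suc m) = ≡ᵇ-refl m

≡ᵇ-sound : ∀ m n → (m ≡ᵇ n) ≡ true → m ≡ n
≡ᵇ-sound m n h = ≡ᵇ⇒≡ m n (subst T (sym h) tt)

≡ᵇ-complete : ∀ {m n} → m ≡ n → (m ≡ᵇ n) ≡ true
≡ᵇ-complete {m} refl = ≡ᵇ-refl m

≡ᵇ-false : ∀ m n → ¬ (m ≡ n) → (m ≡ᵇ n) ≡ false
≡ᵇ-false m n ne with m ≡ᵇ n in e
... | true = ⊥-elim (ne (≡ᵇ-sound m n e))
... | false = refl

<ᵇ-irrefl : ∀ a → (a <ᵇ a) ≡ false
<ᵇ-irrefl zero = refl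
<ᵇ-irrefl (suc a) = <ᵇ-irrefl a

<ᵇ-true : ∀ {a b} → a < b → (a <ᵇ b) ≡ true
<ᵇ-true {zero} {suc b} _ = refl
<ᵇ-true {suc a} {suc b} (s≤s p) = <ᵇ-true p

<ᵇ-suc : ∀ a o → (a <ᵇ suc o) ≡ (a <ᵇ o) ∨ (a ≡ᵇ o)
<ᵇ-suc zero zero = refl
<ᵇ-suc zero (suc o) = refl
<ᵇ-suc (suc a) zero = refl
<ᵇ-suc (suc a) (suc o) = <ᵇ-suc a o

<ᵇ-suc-guard : ∀ a o (g : ℕ) →
  ([ a <ᵇ suc o ]· g) ≡ ([ a <ᵇ o ]· g) + ([ a ≡ᵇ o ]· g)
<ᵇ-suc-guard zero zero g = refl
<ᵇ-suc-guard zero (suc o) g = sym (+-identityʳ g)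
<ᵇ-suc-guard (suc a) zero g = refl
<ᵇ-suc-guard (suc a) (suc o) g = <ᵇ-suc-guard a o g

Compareᵇ : ℕ → ℕ → Set
Compareᵇ a c =
    ((a ≡ᵇ c) ≡ true  × (c ≡ᵇ a) ≡ true  × (a <ᵇ c) ≡ false × (c <ᵇ a) ≡ false)
  ⊎ ((a ≡ᵇ c) ≡ false × (c ≡ᵇ a) ≡ false × (a <ᵇ c) ≡ true  × (c <ᵇ a) ≡ false)
  ⊎ ((a ≡ᵇ c) ≡ false × (c ≡ᵇ a) ≡ false × (a <ᵇ c) ≡ false × (c <ᵇ a) ≡ true)

compareᵇ : ∀ a c → Compareᵇ a c
compareᵇ zero zero = inj₁ (refl , refl , refl , refl)
compareᵇ zero (suc c) = inj₂ (inj₁ (refl , refl , refl , refl))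
compareᵇ (suc a) zero = inj₂ (inj₂ (refl , refl , refl , refl))
compareᵇ (suc a) (suc c) = compareᵇ a c

≟ᶠ-toℕ : ∀ {ℓ} (s t : Fin ℓ) → ⌊ s ≟ᶠ t ⌋ ≡ (toℕ s ≡ᵇ toℕ t)
≟ᶠ-toℕ s t with s ≟ᶠ t
... | yes refl = sym (≡ᵇ-refl (toℕ s))
... | no ne = sym (≡ᵇ-false (toℕ s) (toℕ t) (λ e → ne (toℕ-injective e)))

≟ᶠ-self : ∀ {ℓ} (t : Fin ℓ) → ⌊ t ≟ᶠ t ⌋ ≡ true
≟ᶠ-self t with t ≟ᶠ t
... | yes _ = refl
... | no ne = ⊥-elim (ne refl)

≟ᶠ-≢ : ∀ {ℓ} (s t : Fin ℓ) → ¬ (s ≡ t) → ⌊ s ≟ᶠ t ⌋ ≡ false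
≟ᶠ-≢ s t ne with s ≟ᶠ t
... | yes e = ⊥-elim (ne e)
... | no _ = refl

∧-true : ∀ {a b} → (a ∧ b) ≡ true → (a ≡ true) × (b ≡ true)
∧-true {true} {true} _ = refl , refl

bool-ext : ∀ {a b : Bool} → (a ≡ true → b ≡ true) → (b ≡ true → a ≡ true) → a ≡ b
bool-ext {true} {true} f g = refl
bool-ext {true} {false} f g = sym (f refl)
bool-ext {false} {true} f g = g refl
bool-ext {false} {false} f g = refl

module _ {A : Set} where

  any-cong : {g h : A → Bool} (xs : List A) → (∀ x → g x ≡ h x) → any g xs ≡ any h xs
  any-cong [] eq = refl
  any-cong (x ∷ xs) eq = cong₂ _∨_ (eq x) (any-cong xs eq)

  all-cong : {g h : A → Bool} (xs : List A) → (∀ x → g x ≡ h x) → all g xs ≡ all h xs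
  all-cong [] eq = refl
  all-cong (x ∷ xs) eq = cong₂ _∧_ (eq x) (all-cong xs eq)

  any-∨ : (g h : A → Bool) (xs : List A) → any (λ x → g x ∨ h x) xs ≡ any g xs ∨ any h xs
  any-∨ g h [] = refl
  any-∨ g h (x ∷ xs) = trans (cong ((g x ∨ h x) ∨_) (any-∨ g h xs)) (∨-interchange (g x) (h x) _ _)

  any-++ : (g : A → Bool) (xs ys : List A) → any g (xs ++ ys) ≡ any g xs ∨ any g ys
  any-++ g [] ys = refl
  any-++ g (x ∷ xs) ys = trans (cong (g x ∨_) (any-++ g xs ys)) (sym (∨-assoc (g x) (any g xs) (any g ys)))

module _ {A B : Set} where

  any-map : (g : B → Bool) (f : A → B) (xs : List A) → any g (map f xs) ≡ any (λ x → g (f x)) xs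
  any-map g f [] = refl
  any-map g f (x ∷ xs) = cong (g (f x) ∨_) (any-map g f xs)

  any-filter : (g : B → Bool) (f : A → B) (r : A → Bool) (xs : List A) →
    any g (map f (filterᵇ r xs)) ≡ any (λ x → r x ∧ g (f x)) xs
  any-filter g f r [] = refl
  any-filter g f r (x ∷ xs) with r x
  ... | true = cong (g (f x) ∨_) (any-filter g f r xs)
  ... | false = any-filter g f r xs

==ᴱ-refl : ∀ e → (e ==ᴱ e) ≡ true
==ᴱ-refl (x , y , a , b) rewrite ≡ᵇ-refl x | ≡ᵇ-refl y | ≡ᵇ-refl a | ≡ᵇ-refl b = refl

==ᴱ-sound : ∀ e e' → (e ==ᴱ e') ≡ true → e ≡ e'
==ᴱ-sound (x , y , a , b) (x' , y' , a' , b') h with ∧-true {x ≡ᵇ x'} h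
... | hx , h' with ∧-true {y ≡ᵇ y'} h'
... | hy , h'' with ∧-true {a ≡ᵇ a'} h''
... | ha , hb rewrite ≡ᵇ-sound x x' hx | ≡ᵇ-sound y y' hy | ≡ᵇ-sound a a' ha | ≡ᵇ-sound b b' hb = refl

all⇒∈ᵇ : ∀ (q : Edge → Bool) A → all q A ≡ true → ∀ e → e ∈ᵇ A ≡ true → q e ≡ true
all⇒∈ᵇ q (a ∷ A) h e m with ∧-true {q a} h | e ==ᴱ a in eq
... | qa , _ | true rewrite ==ᴱ-sound e a eq = qa
... | _ , qA | false = all⇒∈ᵇ q A qA e m

∈ᵇ⇒all : ∀ (q : Edge → Bool) A → (∀ e → e ∈ᵇ A ≡ true → q e ≡ true) → all q A ≡ true
∈ᵇ⇒all q [] h = refl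
∈ᵇ⇒all q (a ∷ A) h rewrite h a (cong (_∨ a ∈ᵇ A) (==ᴱ-refl a)) =
  ∈ᵇ⇒all q A (λ e m → h e (trans (cong ((e ==ᴱ a) ∨_) m) (∨-zeroʳ (e ==ᴱ a))))

≈ᵇ-resp-∈ᵇ : ∀ A A' B → (∀ e → e ∈ᵇ A ≡ e ∈ᵇ A') → (A ≈ᵇ B) ≡ (A' ≈ᵇ B)
≈ᵇ-resp-∈ᵇ A A' B mem = cong₂ _∧_
  (bool-ext (λ h → ∈ᵇ⇒all (_∈ᵇ B) A' (λ e m → all⇒∈ᵇ (_∈ᵇ B) A h e (trans (mem e) m)))
            (λ h → ∈ᵇ⇒all (_∈ᵇ B) A (λ e m → all⇒∈ᵇ (_∈ᵇ B) A' h e (trans (sym (mem e)) m))))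
  (all-cong B mem)

≈ᵇ-refl : ∀ A → (A ≈ᵇ A) ≡ true
≈ᵇ-refl A rewrite ∈ᵇ⇒all (_∈ᵇ A) A (λ e m → m) = refl

module _ (m : ℕ) where

  ∈ᵇ-applyUpTo : (E : ℕ → Edge) (e : Edge) → e ∈ᵇ applyUpTo E m ≡ true → Σ ℕ (λ i → i < m × e ≡ E i)
  ∈ᵇ-applyUpTo = go m
    where
    go : ∀ m (E : ℕ → Edge) e → e ∈ᵇ applyUpTo E m ≡ true → Σ ℕ (λ i → i < m × e ≡ E i)
    go (suc m) E e h with e ==ᴱ E 0 in eq
    ... | true = 0 , s≤s z≤n , ==ᴱ-sound e (E 0) eq
    ... | false with go m (λ i → E (suc i)) e h
    ... | i , i<m , e≡ = suc i , s≤s i<m , e≡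

  all-applyUpTo : (G : ℕ → Edge) (q : Edge → Bool) → all q (applyUpTo G m) ≡ true → ∀ j → j < m → q (G j) ≡ true
  all-applyUpTo = go m
    where
    go : ∀ m (G : ℕ → Edge) (q : Edge → Bool) → all q (applyUpTo G m) ≡ true → ∀ j → j < m → q (G j) ≡ true
    go (suc m) G q h zero _ = proj₁ (∧-true {q (G 0)} h)
    go (suc m) G q h (suc j) (s≤s j<m) = go m (λ i → G (suc i)) q (proj₂ (∧-true {q (G 0)} h)) j j<m

  applyUpTo-cong : (G E : ℕ → Edge) → (∀ j → j < m → G j ≡ E j) → applyUpTo G m ≡ applyUpTo E m
  applyUpTo-cong = go m
    where
    go : ∀ m (G E : ℕ → Edge) → (∀ j → j < m → G j ≡ E j) → applyUpTo G m ≡ applyUpTo E m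
    go zero G E h = refl
    go (suc m) G E h =
      cong₂ _∷_ (h 0 (s≤s z≤n)) (go m (λ i → G (suc i)) (λ i → E (suc i)) (λ j j<m → h (suc j) (s≤s j<m)))

  ≈ᵇ-applyUpTo⇒ : (G E : ℕ → Edge) → (∀ j → proj₁ (G j) ≡ suc j) → (∀ j → proj₁ (E j) ≡ suc j) →
    (applyUpTo G m ≈ᵇ applyUpTo E m) ≡ true → ∀ j → j < m → G j ≡ E j
  ≈ᵇ-applyUpTo⇒ G E G-start E-start h j j<m
    with ∈ᵇ-applyUpTo E (G j)
           (all-applyUpTo G (_∈ᵇ applyUpTo E m) (proj₁ (∧-true {all (_∈ᵇ applyUpTo E m) (applyUpTo G m)} h)) j j<m)
  ... | i , _ , Gj≡Ei =
    trans Gj≡Ei (cong E (suc-injective (trans (sym (E-start i)) (trans (sym (cong proj₁ Gj≡Ei)) (G-start j)))))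

  ≈ᵇ-applyUpTo⇐ : (G E : ℕ → Edge) → (∀ j → j < m → G j ≡ E j) → (applyUpTo G m ≈ᵇ applyUpTo E m) ≡ true
  ≈ᵇ-applyUpTo⇐ G E h rewrite applyUpTo-cong G E h = ≈ᵇ-refl (applyUpTo E m)

endpointsOn : ℕ → Edge → ℕ
endpointsOn i (x , y , _ , _) = ([ x ≡ᵇ i ]· 1) + ([ y ≡ᵇ i ]· 1)

endpointsBelow : ℕ → ℕ → Edge → ℕ
endpointsBelow i h (x , y , a , b) = ([ (x ≡ᵇ i) ∧ (a <ᵇ h) ]· 1) + ([ (y ≡ᵇ i) ∧ (b <ᵇ h) ]· 1)

pegCount≡sumL : ∀ i X → pegCount i X ≡ sumL (endpointsOn i) X
pegCount≡sumL i [] = refl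
pegCount≡sumL i (e ∷ X) = cong (endpointsOn i e +_) (pegCount≡sumL i X)

below≡sumL : ∀ i h X → below i h X ≡ sumL (endpointsBelow i h) X
below≡sumL i h [] = refl
below≡sumL i h (e ∷ X) = cong (endpointsBelow i h e +_) (below≡sumL i h X)

-- The two edge maps of D ⊕ rel X: relabelling inside X, then lifting above D.
relabelIn : Diagram → Edge → Edge
relabelIn X (x , y , a , b) = (x , y , suc (below x a X) , suc (below y b X))

liftAbove : Diagram → Edge → Edge
liftAbove D (x , y , a , b) = (x , y , a + pegCount x D , b + pegCount y D)

pegCount-⊕-rel : ∀ i acc X → pegCount i (acc ⊕ rel X) ≡ pegCount i acc + pegCount i X
pegCount-⊕-rel i acc X = begin
  pegCount i (acc ⊕ rel X)
    ≡⟨ pegCount≡sumL i (acc ⊕ rel X) ⟩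
  sumL (endpointsOn i) (acc ++ map (liftAbove acc) (map (relabelIn X) X))
    ≡⟨ sumL-++ (endpointsOn i) acc _ ⟩
  sumL (endpointsOn i) acc + sumL (endpointsOn i) (map (liftAbove acc) (map (relabelIn X) X))
    ≡⟨ cong (sumL (endpointsOn i) acc +_) (trans (sumL-map (endpointsOn i) (liftAbove acc) (map (relabelIn X) X))
                                                   (sumL-map (λ e → endpointsOn i (liftAbove acc e)) (relabelIn X) X)) ⟩
  sumL (endpointsOn i) acc + sumL (endpointsOn i) X
    ≡⟨ sym (cong₂ _+_ (pegCount≡sumL i acc) (pegCount≡sumL i X)) ⟩
  pegCount i acc + pegCount i X
    ∎
  where open ≡-Reasoning

sumL-filter : {B : Set} (g : Edge → ℕ) (r : Edge × B → Bool) (P : List (Edge × B)) →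
  sumL g (map proj₁ (filterᵇ r P)) ≡ sumL (λ p → [ r p ]· g (proj₁ p)) P
sumL-filter g r [] = refl
sumL-filter g r (p ∷ P) with r p
... | true = cong (g (proj₁ p) +_) (sumL-filter g r P)
... | false = sumL-filter g r P

-- (1) The reconstruction of an arbitrary coloured diagram

module Reconstruction {ℓ : ℕ} (D : Diagram) (c : Vec (Fin ℓ) (length D)) where

  coloured : List (Edge × Fin ℓ)
  coloured = zip D (toList c)

  lowerEndpoints : ℕ → ℕ → ℕ
  lowerEndpoints i o = sumL (λ p → [ toℕ (proj₂ p) <ᵇ o ]· endpointsOn i (proj₁ p)) coloured

  sameColourBelow : ℕ → ℕ → ℕ → ℕ
  sameColourBelow i h k =
    sumL (λ p → [ toℕ (proj₂ p) ≡ᵇ k ]· endpointsBelow i h (proj₁ p)) coloured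

  placed : Edge → ℕ → Edge
  placed (x , y , a , b) k =
    (x , y , suc (sameColourBelow x a k) + lowerEndpoints x k , suc (sameColourBelow y b k) + lowerEndpoints y k)

  placedᶜ : Edge × Fin ℓ → Edge
  placedᶜ (e , t) = placed e (toℕ t)

  sumL-class : (g : Edge → ℕ) (t : Fin ℓ) →
    sumL g (colourClass D c t) ≡ sumL (λ p → [ toℕ (proj₂ p) ≡ᵇ toℕ t ]· g (proj₁ p)) coloured
  sumL-class g t = trans (sumL-filter g (λ p → ⌊ proj₂ p ≟ᶠ t ⌋) coloured)
    (sumL-cong coloured (λ p → cong ([_]· g (proj₁ p)) (≟ᶠ-toℕ (proj₂ p) t)))

  below-class : ∀ i h t → below i h (colourClass D c t) ≡ sameColourBelow i h (toℕ t)
  below-class i h t = trans (below≡sumL i h (colourClass D c t)) (sumL-class (endpointsBelow i h) t)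

  -- The partial reconstruction after gluing the colour blocks 0, …, o-1:
  -- its peg counts and its edges.
  Stage : Diagram → ℕ → Set
  Stage acc o = (∀ i → pegCount i acc ≡ lowerEndpoints i o)
              × (∀ e → e ∈ᵇ acc ≡ any (λ p → (toℕ (proj₂ p) <ᵇ o) ∧ (e ==ᴱ placedᶜ p)) coloured)

  glue : Diagram → Fin ℓ → Diagram
  glue acc t = acc ⊕ rel (colourClass D c t)

  stage-pegCount : ∀ acc t → Stage acc (toℕ t) → ∀ i → pegCount i (glue acc t) ≡ lowerEndpoints i (suc (toℕ t))
  stage-pegCount acc t (counts , _) i = begin
    pegCount i (glue acc t)
      ≡⟨ pegCount-⊕-rel i acc (colourClass D c t) ⟩
    pegCount i acc + pegCount i (colourClass D c t)
      ≡⟨ cong₂ _+_ (counts i) (trans (pegCount≡sumL i (colourClass D c t)) (sumL-class (endpointsOn i) t)) ⟩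
    lowerEndpoints i o + sumL (λ p → [ toℕ (proj₂ p) ≡ᵇ o ]· endpointsOn i (proj₁ p)) coloured
      ≡⟨ sym (sumL-+ _ _ coloured) ⟩
    sumL (λ p → ([ toℕ (proj₂ p) <ᵇ o ]· endpointsOn i (proj₁ p))
              + ([ toℕ (proj₂ p) ≡ᵇ o ]· endpointsOn i (proj₁ p))) coloured
      ≡⟨ sumL-cong coloured (λ p → sym (<ᵇ-suc-guard (toℕ (proj₂ p)) o (endpointsOn i (proj₁ p)))) ⟩
    lowerEndpoints i (suc o)
      ∎
    where
    open ≡-Reasoning
    o = toℕ t

  stage-glued : ∀ acc t → Stage acc (toℕ t) → ∀ q →
    liftAbove acc (relabelIn (colourClass D c t) q) ≡ placed q (toℕ t)
  stage-glued acc t (counts , _) q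
    rewrite counts (proj₁ q) | counts (proj₁ (proj₂ q))
          | below-class (proj₁ q) (proj₁ (proj₂ (proj₂ q))) t
          | below-class (proj₁ (proj₂ q)) (proj₂ (proj₂ (proj₂ q))) t = refl

  stage-∈ᵇ : ∀ acc t → Stage acc (toℕ t) →
    ∀ e → e ∈ᵇ glue acc t ≡ any (λ p → (toℕ (proj₂ p) <ᵇ suc (toℕ t)) ∧ (e ==ᴱ placedᶜ p)) coloured
  stage-∈ᵇ acc t st@(_ , members) e = begin
    any (e ==ᴱ_) (acc ++ map (liftAbove acc) (map (relabelIn X) X))
      ≡⟨ any-++ (e ==ᴱ_) acc _ ⟩
    (e ∈ᵇ acc) ∨ any (e ==ᴱ_) (map (liftAbove acc) (map (relabelIn X) X))
      ≡⟨ cong₂ _∨_ (members e) (trans (any-map (e ==ᴱ_) (liftAbove acc) (map (relabelIn X) X))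
                                      (any-map (λ q → e ==ᴱ liftAbove acc q) (relabelIn X) X)) ⟩
    earlier o ∨ any (λ q → e ==ᴱ liftAbove acc (relabelIn X q)) X
      ≡⟨ cong (earlier o ∨_) (trans (any-filter (λ q → e ==ᴱ liftAbove acc (relabelIn X q)) proj₁
                                                (λ p → ⌊ proj₂ p ≟ᶠ t ⌋) coloured)
                                    (any-cong coloured this-block)) ⟩
    earlier o ∨ any (λ p → (toℕ (proj₂ p) ≡ᵇ o) ∧ (e ==ᴱ placedᶜ p)) coloured
      ≡⟨ sym (any-∨ _ _ coloured) ⟩
    any (λ p → ((toℕ (proj₂ p) <ᵇ o) ∧ (e ==ᴱ placedᶜ p)) ∨ ((toℕ (proj₂ p) ≡ᵇ o) ∧ (e ==ᴱ placedᶜ p))) coloured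
      ≡⟨ any-cong coloured (λ p → trans (sym (∧-distribʳ-∨ (e ==ᴱ placedᶜ p) (toℕ (proj₂ p) <ᵇ o) _))
                                        (cong (_∧ (e ==ᴱ placedᶜ p)) (sym (<ᵇ-suc (toℕ (proj₂ p)) o)))) ⟩
    any (λ p → (toℕ (proj₂ p) <ᵇ suc o) ∧ (e ==ᴱ placedᶜ p)) coloured
      ∎
    where
    open ≡-Reasoning
    X = colourClass D c t
    o = toℕ t
    earlier : ℕ → Bool
    earlier o = any (λ p → (toℕ (proj₂ p) <ᵇ o) ∧ (e ==ᴱ placedᶜ p)) coloured
    this-block : ∀ p → (⌊ proj₂ p ≟ᶠ t ⌋ ∧ (e ==ᴱ liftAbove acc (relabelIn X (proj₁ p))))
                     ≡ ((toℕ (proj₂ p) ≡ᵇ o) ∧ (e ==ᴱ placedᶜ p))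
    this-block (q , s) with s ≟ᶠ t
    ... | yes refl = cong₂ _∧_ (sym (≡ᵇ-refl o)) (cong (e ==ᴱ_) (stage-glued acc t st q))
    ... | no s≢t rewrite ≡ᵇ-false (toℕ s) o (λ eq → s≢t (toℕ-injective eq)) = refl

  Ascending : List (Fin ℓ) → ℕ → Set
  Ascending [] o = ⊤
  Ascending (t ∷ ts) o = (toℕ t ≡ o) × Ascending ts (suc o)

  stage-foldl : ∀ ts acc o → Ascending ts o → Stage acc o → Stage (foldl glue acc ts) (o + length ts)
  stage-foldl [] acc o _ st rewrite +-identityʳ o = st
  stage-foldl (t ∷ ts) acc o (refl , asc) st rewrite +-suc o (length ts) =
    stage-foldl ts (glue acc t) (suc o) asc (stage-pegCount acc t st , stage-∈ᵇ acc t st)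

  allFin-ascending : Ascending (allFin ℓ) 0
  allFin-ascending = go (λ i → i) 0 (λ i → refl)
    where
    go : ∀ {k} (g : Fin k → Fin ℓ) o → (∀ i → toℕ (g i) ≡ o + toℕ i) → Ascending (tabulate g) o
    go {zero} g o h = tt
    go {suc k} g o h = trans (h fzero) (+-identityʳ o)
                     , go (λ i → g (fsuc i)) (suc o) (λ i → trans (h (fsuc i)) (+-suc o (toℕ i)))

  stage-empty : Stage [] 0
  stage-empty = (λ i → sym (no-lower i coloured)) , (λ e → sym (no-earlier e coloured))
    where
    no-lower : ∀ i (Q : List (Edge × Fin ℓ)) →
      sumL (λ p → [ toℕ (proj₂ p) <ᵇ 0 ]· endpointsOn i (proj₁ p)) Q ≡ 0
    no-lower i [] = refl
    no-lower i (p ∷ Q) = no-lower i Q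
    no-earlier : ∀ e (Q : List (Edge × Fin ℓ)) → any (λ p → (toℕ (proj₂ p) <ᵇ 0) ∧ (e ==ᴱ placedᶜ p)) Q ≡ false
    no-earlier e [] = refl
    no-earlier e (p ∷ Q) = no-earlier e Q

  reconstruct-∈ᵇ : ∀ e → e ∈ᵇ reconstruct D c ≡ any (λ p → e ==ᴱ placedᶜ p) coloured
  reconstruct-∈ᵇ e = trans (proj₂ final e) (any-cong coloured (λ p → cong (_∧ (e ==ᴱ placedᶜ p)) (<ᵇ-true (toℕ<n (proj₂ p)))))
    where
    final : Stage (reconstruct D c) ℓ
    final = subst (Stage (reconstruct D c)) (length-tabulate {n = ℓ} (λ i → i))
                  (stage-foldl (allFin ℓ) [] 0 allFin-ascending stage-empty)

colourAt : ∀ {ℓ k} → Vec (Fin ℓ) k → ℕ → ℕ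
colourAt []ᵛ _ = 0
colourAt (t ∷ᵛ c) zero = toℕ t
colourAt (t ∷ᵛ c) (suc i) = colourAt c i

module _ {ℓ : ℕ} where

  sumL-zip-applyUpTo : ∀ m (E : ℕ → Edge) (c : Vec (Fin ℓ) (length (applyUpTo E m))) (g : Edge → ℕ → ℕ) →
    sumL (λ p → g (proj₁ p) (toℕ (proj₂ p))) (zip (applyUpTo E m) (toList c)) ≡ sumTo m (λ j → g (E j) (colourAt c j))
  sumL-zip-applyUpTo zero E []ᵛ g = refl
  sumL-zip-applyUpTo (suc m) E (t ∷ᵛ c) g = cong (g (E 0) (toℕ t) +_) (sumL-zip-applyUpTo m (λ i → E (suc i)) c g)

  map-zip-applyUpTo : ∀ m (E : ℕ → Edge) (c : Vec (Fin ℓ) (length (applyUpTo E m))) (h : Edge → ℕ → Edge) →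
    map (λ p → h (proj₁ p) (toℕ (proj₂ p))) (zip (applyUpTo E m) (toList c)) ≡ applyUpTo (λ j → h (E j) (colourAt c j)) m
  map-zip-applyUpTo zero E []ᵛ h = refl
  map-zip-applyUpTo (suc m) E (t ∷ᵛ c) h = cong (h (E 0) (toℕ t) ∷_) (map-zip-applyUpTo m (λ i → E (suc i)) c h)

-- (2) Reconstructing a chain

chainEdge : ∀ {n} → Vec Bool n → ℕ → Edge
chainEdge s k = (suc k , suc (suc k) , xPeg s (suc k) , yPeg s (suc (suc k)))

-- The local condition at an inner peg whose upper endpoint belongs to the left
-- edge (b = false) or the right edge (b = true), the edges having colours a, c:
-- the edge whose endpoint is lower must not have the larger colour.
orderOK : Bool → ℕ → ℕ → Bool
orderOK b a c = if b then not (c <ᵇ a) else not (a <ᵇ c)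

compatible : ∀ {n} → Vec Bool n → (ℕ → ℕ) → Bool
compatible []ᵛ u = true
compatible (b ∷ᵛ s) u = orderOK b (u 0) (u 1) ∧ compatible s (λ i → u (suc i))

compatible⇒ : ∀ {n} (s : Vec Bool n) u → compatible s u ≡ true →
  ∀ j → j < n → orderOK (lookupB s j) (u j) (u (suc j)) ≡ true
compatible⇒ (b ∷ᵛ s) u h zero _ = proj₁ (∧-true {orderOK b (u 0) (u 1)} h)
compatible⇒ (b ∷ᵛ s) u h (suc j) (s≤s j<n) =
  compatible⇒ s (λ i → u (suc i)) (proj₂ (∧-true {orderOK b (u 0) (u 1)} h)) j j<n

compatible⇐ : ∀ {n} (s : Vec Bool n) u → (∀ j → j < n → orderOK (lookupB s j) (u j) (u (suc j)) ≡ true) →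
  compatible s u ≡ true
compatible⇐ []ᵛ u h = refl
compatible⇐ (b ∷ᵛ s) u h rewrite h 0 (s≤s z≤n) = compatible⇐ s (λ i → u (suc i)) (λ j j<n → h (suc j) (s≤s j<n))

-- The two tests deciding whether the endpoints on an inner peg land correctly:
-- the left edge has colour a, the right edge colour c, and the heights
-- (x_j, y_j) are (2,1) if b and (1,2) otherwise.
leftEndpointOK : ∀ b a c →
  (suc ([ a ≡ᵇ c ]· [ (if b then 1 else 2) <ᵇ (if b then 2 else 1) ]· 1 + [ a <ᵇ c ]· 1) ≡ᵇ (if b then 2 else 1))
  ≡ orderOK b a c
leftEndpointOK true a c with compareᵇ a c
... | inj₁ (e₁ , _ , e₃ , e₄) rewrite e₁ | e₃ | e₄ = refl
... | inj₂ (inj₁ (e₁ , _ , e₃ , e₄)) rewrite e₁ | e₃ | e₄ = refl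
... | inj₂ (inj₂ (e₁ , _ , e₃ , e₄)) rewrite e₁ | e₃ | e₄ = refl
leftEndpointOK false a c with compareᵇ a c
... | inj₁ (e₁ , _ , e₃ , _) rewrite e₁ | e₃ = refl
... | inj₂ (inj₁ (e₁ , _ , e₃ , _)) rewrite e₁ | e₃ = refl
... | inj₂ (inj₂ (e₁ , _ , e₃ , _)) rewrite e₁ | e₃ = refl

rightEndpointOK : ∀ b a c →
  (suc ([ c ≡ᵇ a ]· [ (if b then 2 else 1) <ᵇ (if b then 1 else 2) ]· 1 + [ c <ᵇ a ]· 1) ≡ᵇ (if b then 1 else 2))
  ≡ orderOK b a c
rightEndpointOK true a c with compareᵇ a c
... | inj₁ (_ , e₂ , _ , e₄) rewrite e₂ | e₄ = refl
... | inj₂ (inj₁ (_ , e₂ , _ , e₄)) rewrite e₂ | e₄ = refl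
... | inj₂ (inj₂ (_ , e₂ , _ , e₄)) rewrite e₂ | e₄ = refl
rightEndpointOK false a c with compareᵇ a c
... | inj₁ (_ , e₂ , e₃ , e₄) rewrite e₂ | e₃ | e₄ = refl
... | inj₂ (inj₁ (_ , e₂ , e₃ , e₄)) rewrite e₂ | e₃ | e₄ = refl
... | inj₂ (inj₂ (_ , e₂ , e₃ , e₄)) rewrite e₂ | e₃ | e₄ = refl

guard-pair : ∀ A a b x y → [ A ]· ([ a ]· x + [ b ]· y) ≡ [ a ]· [ A ]· x + [ b ]· [ A ]· y
guard-pair true a b x y = refl
guard-pair false true true x y = refl
guard-pair false true false x y = refl
guard-pair false false true x y = refl
guard-pair false false false x y = refl

guard-∧ : ∀ a b x → [ a ∧ b ]· x ≡ [ a ]· [ b ]· x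
guard-∧ true b x = refl
guard-∧ false b x = refl

guard-swap : ∀ A a x → [ A ]· ([ a ]· x + 0) ≡ [ a ]· [ A ]· x
guard-swap true a x = +-identityʳ ([ a ]· x)
guard-swap false true x = refl
guard-swap false false x = refl

sumTo-two-points : ∀ m p q (β γ F : ℕ → ℕ) → (∀ i → F i ≡ [ i ≡ᵇ p ]· β i + [ i ≡ᵇ q ]· γ i) →
  sumTo m F ≡ [ p <ᵇ m ]· β p + [ q <ᵇ m ]· γ q
sumTo-two-points m p q β γ F eq =
  trans (sumTo-cong m eq) (trans (sumTo-+ m _ _) (cong₂ _+_ (sumTo-point m p β) (sumTo-point m q γ)))

module Chain {n : ℕ} (s : Vec Bool n) {ℓ : ℕ} (c : Vec (Fin ℓ) (length (webDiagram s))) where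
  open Reconstruction (webDiagram s) c

  E : ℕ → Edge
  E = chainEdge s

  u : ℕ → ℕ
  u = colourAt c

  xᵢ yᵢ : ℕ → ℕ
  xᵢ j = xPeg s j
  yᵢ j = yPeg s j

  -- Inner peg j+2 carries the right end of edge j and the left end of edge j+1.
  sameColourBelow-inner : ∀ j h k → sameColourBelow (suc (suc j)) h k ≡
    [ suc j <ᵇ suc n ]· [ u (suc j) ≡ᵇ k ]· [ xᵢ (suc (suc j)) <ᵇ h ]· 1 + [ j <ᵇ suc n ]· [ u j ≡ᵇ k ]· [ yᵢ (suc (suc j)) <ᵇ h ]· 1
  sameColourBelow-inner j h k =
    trans (sumL-zip-applyUpTo (suc n) E c (λ e a → [ a ≡ᵇ k ]· endpointsBelow (suc (suc j)) h e))
          (sumTo-two-points (suc n) (suc j) j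
            (λ i → [ u i ≡ᵇ k ]· [ xᵢ (suc i) <ᵇ h ]· 1) (λ i → [ u i ≡ᵇ k ]· [ yᵢ (suc (suc i)) <ᵇ h ]· 1)
            (λ i → [ u i ≡ᵇ k ]· endpointsBelow (suc (suc j)) h (E i)) λ i →
            trans (cong ([ u i ≡ᵇ k ]·_) (cong₂ _+_ (guard-∧ (i ≡ᵇ suc j) (xᵢ (suc i) <ᵇ h) 1)
                                                    (guard-∧ (i ≡ᵇ j) (yᵢ (suc (suc i)) <ᵇ h) 1)))
                  (guard-pair (u i ≡ᵇ k) (i ≡ᵇ suc j) (i ≡ᵇ j) ([ xᵢ (suc i) <ᵇ h ]· 1) ([ yᵢ (suc (suc i)) <ᵇ h ]· 1)))

  lowerEndpoints-inner : ∀ j k → lowerEndpoints (suc (suc j)) k ≡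
    [ suc j <ᵇ suc n ]· [ u (suc j) <ᵇ k ]· 1 + [ j <ᵇ suc n ]· [ u j <ᵇ k ]· 1
  lowerEndpoints-inner j k =
    trans (sumL-zip-applyUpTo (suc n) E c (λ e a → [ a <ᵇ k ]· endpointsOn (suc (suc j)) e))
          (sumTo-two-points (suc n) (suc j) j (λ i → [ u i <ᵇ k ]· 1) (λ i → [ u i <ᵇ k ]· 1)
            (λ i → [ u i <ᵇ k ]· endpointsOn (suc (suc j)) (E i)) λ i → guard-pair (u i <ᵇ k) (i ≡ᵇ suc j) (i ≡ᵇ j) 1 1)

  -- Peg 1 carries only the left end of edge 0.
  sameColourBelow-first : ∀ h k → sameColourBelow 1 h k ≡ [ u 0 ≡ᵇ k ]· [ xᵢ 1 <ᵇ h ]· 1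
  sameColourBelow-first h k =
    trans (sumL-zip-applyUpTo (suc n) E c (λ e a → [ a ≡ᵇ k ]· endpointsBelow 1 h e))
          (trans (sumTo-cong (suc n) λ i →
                    trans (cong (λ z → [ u i ≡ᵇ k ]· (z + 0)) (guard-∧ (i ≡ᵇ 0) (xᵢ (suc i) <ᵇ h) 1))
                          (guard-swap (u i ≡ᵇ k) (i ≡ᵇ 0) ([ xᵢ (suc i) <ᵇ h ]· 1)))
                 (sumTo-point (suc n) 0 (λ i → [ u i ≡ᵇ k ]· [ xᵢ (suc i) <ᵇ h ]· 1)))

  lowerEndpoints-first : ∀ k → lowerEndpoints 1 k ≡ [ u 0 <ᵇ k ]· 1
  lowerEndpoints-first k =
    trans (sumL-zip-applyUpTo (suc n) E c (λ e a → [ a <ᵇ k ]· endpointsOn 1 e))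
          (trans (sumTo-cong (suc n) (λ i → guard-swap (u i <ᵇ k) (i ≡ᵇ 0) 1)) (sumTo-point (suc n) 0 (λ i → [ u i <ᵇ k ]· 1)))

  leftHeight rightHeight : ℕ → ℕ
  leftHeight j = suc (sameColourBelow (suc j) (xᵢ (suc j)) (u j)) + lowerEndpoints (suc j) (u j)
  rightHeight j = suc (sameColourBelow (suc (suc j)) (yᵢ (suc (suc j))) (u j)) + lowerEndpoints (suc (suc j)) (u j)

  leftHeight-first : leftHeight 0 ≡ 1
  leftHeight-first rewrite sameColourBelow-first (xᵢ 1) (u 0) | lowerEndpoints-first (u 0)
                         | <ᵇ-irrefl (u 0) | []·-zero (u 0 ≡ᵇ u 0) = refl

  leftHeight-inner : ∀ j → j < n → leftHeight (suc j) ≡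
    suc ([ u j ≡ᵇ u (suc j) ]· [ yᵢ (suc (suc j)) <ᵇ xᵢ (suc (suc j)) ]· 1 + [ u j <ᵇ u (suc j) ]· 1)
  leftHeight-inner j j<n
    rewrite sameColourBelow-inner j (xᵢ (suc (suc j))) (u (suc j)) | lowerEndpoints-inner j (u (suc j))
          | <ᵇ-irrefl (xᵢ (suc (suc j))) | ≡ᵇ-refl (u (suc j)) | <ᵇ-irrefl (u (suc j))
          | <ᵇ-true (m<n⇒m<1+n j<n) | []·-zero (suc j <ᵇ suc n) = refl

  rightHeight-formula : ∀ j → j < suc n → rightHeight j ≡
    suc ([ suc j <ᵇ suc n ]· [ u (suc j) ≡ᵇ u j ]· [ xᵢ (suc (suc j)) <ᵇ yᵢ (suc (suc j)) ]· 1
       + [ suc j <ᵇ suc n ]· [ u (suc j) <ᵇ u j ]· 1)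
  rightHeight-formula j j<m
    rewrite sameColourBelow-inner j (yᵢ (suc (suc j))) (u j) | lowerEndpoints-inner j (u j)
          | <ᵇ-irrefl (yᵢ (suc (suc j))) | ≡ᵇ-refl (u j) | <ᵇ-irrefl (u j) | <ᵇ-true j<m
          = cong suc (cong₂ _+_ (+-identityʳ ([ suc j <ᵇ suc n ]· [ u (suc j) ≡ᵇ u j ]· [ xᵢ (suc (suc j)) <ᵇ yᵢ (suc (suc j)) ]· 1))
                                (+-identityʳ ([ suc j <ᵇ suc n ]· [ u (suc j) <ᵇ u j ]· 1)))

  yᵢ-inner : ∀ j → j < n → yᵢ (suc (suc j)) ≡ (if lookupB s j then 1 else 2)
  yᵢ-inner j j<n = cong (λ b → if b then 1 else (if lookupB s j then 1 else 2)) (≡ᵇ-false (suc (suc j)) (n + 2) j+2≢n+2)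
    where
    j+2≢n+2 : ¬ (suc (suc j) ≡ n + 2)
    j+2≢n+2 eq = <-irrefl (suc-injective (suc-injective (trans eq (+-comm n 2)))) j<n

  yᵢ-last : yᵢ (suc (suc n)) ≡ 1
  yᵢ-last rewrite +-comm n 2 | ≡ᵇ-refl n = refl

  left-correct : ∀ j → j < n → (leftHeight (suc j) ≡ᵇ xᵢ (suc (suc j))) ≡ orderOK (lookupB s j) (u j) (u (suc j))
  left-correct j j<n rewrite leftHeight-inner j j<n | yᵢ-inner j j<n = leftEndpointOK (lookupB s j) (u j) (u (suc j))

  right-correct : ∀ j → j < n → (rightHeight j ≡ᵇ yᵢ (suc (suc j))) ≡ orderOK (lookupB s j) (u j) (u (suc j))
  right-correct j j<n rewrite rightHeight-formula j (m<n⇒m<1+n j<n) | yᵢ-inner j j<n | <ᵇ-true (s≤s j<n) =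
    rightEndpointOK (lookupB s j) (u j) (u (suc j))

  right-last : rightHeight n ≡ yᵢ (suc (suc n))
  right-last rewrite rightHeight-formula n (n<1+n n) | <ᵇ-irrefl n | yᵢ-last = refl

  placed-correct : compatible s u ≡ true → ∀ j → j < suc n → placed (E j) (u j) ≡ E j
  placed-correct ok j j<m = cong₂ (λ a b → (suc j , suc (suc j) , a , b)) (left j j<m) (right j j<m)
    where
    left : ∀ j → j < suc n → leftHeight j ≡ xᵢ (suc j)
    left zero _ = leftHeight-first
    left (suc j) j<m = ≡ᵇ-sound _ _ (trans (left-correct j (≤-pred j<m)) (compatible⇒ s u ok j (≤-pred j<m)))
    right : ∀ j → j < suc n → rightHeight j ≡ yᵢ (suc (suc j))
    right j j<m with m<1+n⇒m<n∨m≡n j<m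
    ... | inj₁ j<n = ≡ᵇ-sound _ _ (trans (right-correct j j<n) (compatible⇒ s u ok j j<n))
    ... | inj₂ refl = right-last

  chain-≈ᵇ : (reconstruct (webDiagram s) c ≈ᵇ webDiagram s) ≡ compatible s u
  chain-≈ᵇ = begin
    reconstruct (webDiagram s) c ≈ᵇ webDiagram s
      ≡⟨ ≈ᵇ-resp-∈ᵇ (reconstruct (webDiagram s) c) (map placedᶜ coloured) (webDiagram s)
                    (λ e → trans (reconstruct-∈ᵇ e) (sym (any-map (e ==ᴱ_) placedᶜ coloured))) ⟩
    map placedᶜ coloured ≈ᵇ webDiagram s
      ≡⟨ cong (_≈ᵇ webDiagram s) (map-zip-applyUpTo (suc n) E c placed) ⟩
    applyUpTo (λ j → placed (E j) (u j)) (suc n) ≈ᵇ applyUpTo E (suc n)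
      ≡⟨ bool-ext (λ h → compatible⇐ s u (λ j j<n → necessary h j j<n)) sufficient ⟩
    compatible s u
      ∎
    where
    open ≡-Reasoning
    necessary : (applyUpTo (λ j → placed (E j) (u j)) (suc n) ≈ᵇ applyUpTo E (suc n)) ≡ true →
      ∀ j → j < n → orderOK (lookupB s j) (u j) (u (suc j)) ≡ true
    necessary h j j<n = trans (sym (right-correct j j<n)) (≡ᵇ-complete (cong (λ e → proj₂ (proj₂ (proj₂ e)))
      (≈ᵇ-applyUpTo⇒ (suc n) (λ j → placed (E j) (u j)) E (λ _ → refl) (λ _ → refl) h j (m<n⇒m<1+n j<n))))
    sufficient : compatible s u ≡ true → (applyUpTo (λ j → placed (E j) (u j)) (suc n) ≈ᵇ applyUpTo E (suc n)) ≡ true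
    sufficient ok = ≈ᵇ-applyUpTo⇐ (suc n) (λ j → placed (E j) (u j)) E (placed-correct ok)

-- Counting the web diagrams fixed by a colouring

weight : ℕ → (ℕ → ℕ) → ℕ
weight zero u = 1
weight (suc n) u = (if u 0 ≡ᵇ u 1 then 2 else 1) * weight n (λ i → u (suc i))

-- At a peg whose two edges have distinct colours exactly one orientation is
-- compatible; when the colours agree both are.
orientations : ∀ a c W → [ orderOK true a c ]· W + ([ orderOK false a c ]· W + 0) ≡ (if a ≡ᵇ c then 2 else 1) * W
orientations a c W with compareᵇ a c
... | inj₁ (e₁ , _ , e₃ , e₄) rewrite e₁ | e₃ | e₄ = refl
... | inj₂ (inj₁ (e₁ , _ , e₃ , e₄)) rewrite e₁ | e₃ | e₄ = refl
... | inj₂ (inj₂ (e₁ , _ , e₃ , e₄)) rewrite e₁ | e₃ | e₄ = refl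

compatible-count : ∀ n u → sumL (λ s → [ compatible s u ]· 1) (allBoolVecs n) ≡ weight n u
compatible-count zero u = refl
compatible-count (suc n) u = begin
  sumL g (concatMap (λ b → map (b ∷ᵛ_) (allBoolVecs n)) (true ∷ false ∷ []))
    ≡⟨ sumL-concatMap g (λ b → map (b ∷ᵛ_) (allBoolVecs n)) (true ∷ false ∷ []) ⟩
  sumL g (map (true ∷ᵛ_) (allBoolVecs n)) + (sumL g (map (false ∷ᵛ_) (allBoolVecs n)) + 0)
    ≡⟨ cong₂ (λ x y → x + (y + 0)) (oriented true) (oriented false) ⟩
  [ orderOK true (u 0) (u 1) ]· weight n u' + ([ orderOK false (u 0) (u 1) ]· weight n u' + 0)
    ≡⟨ orientations (u 0) (u 1) (weight n u') ⟩
  weight (suc n) u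
    ∎
  where
  open ≡-Reasoning
  g : Vec Bool (suc n) → ℕ
  g s = [ compatible s u ]· 1
  u' : ℕ → ℕ
  u' i = u (suc i)
  oriented : ∀ b → sumL g (map (b ∷ᵛ_) (allBoolVecs n)) ≡ [ orderOK b (u 0) (u 1) ]· weight n u'
  oriented b = trans (sumL-map g (b ∷ᵛ_) (allBoolVecs n))
                     (trans (sumL-guard (orderOK b (u 0) (u 1)) (λ s → compatible s u') (allBoolVecs n))
                            (cong ([ orderOK b (u 0) (u 1) ]·_) (compatible-count n u')))

f-web : ∀ n (s : Vec Bool n) ℓ →
  f (webDiagram s) (webDiagram s) ℓ ≡ sumL (λ c → [ isSurjective c ∧ compatible s (colourAt c) ]· 1) (allVecs ℓ (suc n))
f-web n s ℓ = begin
  count (λ c → isSurjective c ∧ (reconstruct (webDiagram s) c ≈ᵇ webDiagram s)) (allVecs ℓ (length (webDiagram s)))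
    ≡⟨ count-cong (allVecs ℓ (length (webDiagram s))) (λ c → cong (isSurjective c ∧_) (Chain.chain-≈ᵇ s c)) ⟩
  count (λ c → isSurjective c ∧ compatible s (colourAt c)) (allVecs ℓ (length (webDiagram s)))
    ≡⟨ cong (λ k → count (λ c → isSurjective c ∧ compatible s (colourAt c)) (allVecs ℓ k))
            (length-applyUpTo (chainEdge s) (suc n)) ⟩
  count (λ c → isSurjective c ∧ compatible s (colourAt c)) (allVecs ℓ (suc n))
    ≡⟨ count≡sumL _ (allVecs ℓ (suc n)) ⟩
  sumL (λ c → [ isSurjective c ∧ compatible s (colourAt c) ]· 1) (allVecs ℓ (suc n))
    ∎
  where
  open ≡-Reasoning
  count-cong : {A : Set} {p q : A → Bool} (xs : List A) → (∀ x → p x ≡ q x) → count p xs ≡ count q xs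
  count-cong {p = p} {q} xs h =
    trans (count≡sumL p xs) (trans (sumL-cong xs (λ x → cong ([_]· 1) (h x))) (sym (count≡sumL q xs)))

surjWeight : ℕ → ℕ → ℕ
surjWeight m ℓ = sumL (λ c → [ isSurjective c ]· weight m (colourAt c)) (allVecs ℓ (suc m))

Σ-f-web : ∀ n ℓ → sumL (λ s → f (webDiagram s) (webDiagram s) ℓ) (allBoolVecs n) ≡ surjWeight n ℓ
Σ-f-web n ℓ = begin
  sumL (λ s → f (webDiagram s) (webDiagram s) ℓ) (allBoolVecs n)
    ≡⟨ sumL-cong (allBoolVecs n) (λ s → f-web n s ℓ) ⟩
  sumL (λ s → sumL (λ c → ind s c) (allVecs ℓ (suc n))) (allBoolVecs n)
    ≡⟨ sumL-swap ind (allBoolVecs n) (allVecs ℓ (suc n)) ⟩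
  sumL (λ c → sumL (λ s → ind s c) (allBoolVecs n)) (allVecs ℓ (suc n))
    ≡⟨ sumL-cong (allVecs ℓ (suc n)) (λ c → trans (sumL-guard (isSurjective c) (λ s → compatible s (colourAt c)) (allBoolVecs n))
                                                  (cong ([ isSurjective c ]·_) (compatible-count n (colourAt c)))) ⟩
  surjWeight n ℓ
    ∎
  where
  open ≡-Reasoning
  ind : Vec Bool n → Vec (Fin ℓ) (suc n) → ℕ
  ind s c = [ isSurjective c ∧ compatible s (colourAt c) ]· 1

-- (3) The recurrence for the weight of surjective colourings

all-tabulate⇒ : ∀ {A : Set} n (q : A → Bool) (h : Fin n → A) → all q (tabulate h) ≡ true → ∀ i → q (h i) ≡ true
all-tabulate⇒ (suc n) q h e fzero = proj₁ (∧-true {q (h fzero)} e)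
all-tabulate⇒ (suc n) q h e (fsuc i) = all-tabulate⇒ n q (λ i → h (fsuc i)) (proj₂ (∧-true {q (h fzero)} e)) i

all-tabulate⇐ : ∀ {A : Set} n (q : A → Bool) (h : Fin n → A) → (∀ i → q (h i) ≡ true) → all q (tabulate h) ≡ true
all-tabulate⇐ zero q h e = refl
all-tabulate⇐ (suc n) q h e rewrite e fzero = all-tabulate⇐ n q (λ i → h (fsuc i)) (λ i → e (fsuc i))

occurs : ∀ {ℓ k} → Fin ℓ → Vec (Fin ℓ) k → Bool
occurs t c = any (λ s → ⌊ s ≟ᶠ t ⌋) (toList c)

surjective⇒occurs : ∀ {ℓ k} (c : Vec (Fin ℓ) k) → isSurjective c ≡ true → ∀ t → occurs t c ≡ true
surjective⇒occurs {ℓ} c e t = all-tabulate⇒ ℓ (λ t → occurs t c) (λ i → i) e t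

occurs⇒surjective : ∀ {ℓ k} (c : Vec (Fin ℓ) k) → (∀ t → occurs t c ≡ true) → isSurjective c ≡ true
occurs⇒surjective {ℓ} c e = all-tabulate⇐ ℓ (λ t → occurs t c) (λ i → i) e

surjective-cons : ∀ {ℓ k} (t : Fin ℓ) (c : Vec (Fin ℓ) k) (W : ℕ) →
  [ isSurjective (t ∷ᵛ c) ]· W ≡ [ isSurjective c ]· W + (if occurs t c then 0 else [ isSurjective (t ∷ᵛ c) ]· W)
surjective-cons {ℓ} t c W with occurs t c in t∈c
... | true = trans (cong ([_]· W) (all-cong (allFin ℓ) occurs-cons)) (sym (+-identityʳ ([ isSurjective c ]· W)))
  where
  occurs-cons : ∀ v → (⌊ t ≟ᶠ v ⌋ ∨ occurs v c) ≡ occurs v c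
  occurs-cons v with t ≟ᶠ v
  ... | yes refl = sym t∈c
  ... | no _ = refl
... | false with isSurjective c in surj
...   | true = ⊥-elim (true≢false (trans (sym (surjective⇒occurs c surj t)) t∈c))
  where
  true≢false : true ≡ false → ⊥
  true≢false ()
...   | false = refl

-- Colourings avoiding t are the colourings by the other ℓ colours, inserted via punchIn t.
module _ {ℓ : ℕ} (t : Fin (suc ℓ)) where

  ≟-punchIn : ∀ (a b : Fin ℓ) → ⌊ punchIn t a ≟ᶠ punchIn t b ⌋ ≡ ⌊ a ≟ᶠ b ⌋
  ≟-punchIn a b with a ≟ᶠ b
  ... | yes refl = ≟ᶠ-self (punchIn t a)
  ... | no a≢b = ≟ᶠ-≢ _ _ (λ eq → a≢b (punchIn-injective t a b eq))

  occurs-punchIn : ∀ {k} (v : Fin ℓ) (d : Vec (Fin ℓ) k) → occurs (punchIn t v) (Vec.map (punchIn t) d) ≡ occurs v d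
  occurs-punchIn v []ᵛ = refl
  occurs-punchIn v (x ∷ᵛ d) = cong₂ _∨_ (≟-punchIn x v) (occurs-punchIn v d)

  avoids-punched : ∀ {k} (d : Vec (Fin ℓ) k) → occurs t (Vec.map (punchIn t) d) ≡ false
  avoids-punched []ᵛ = refl
  avoids-punched (x ∷ᵛ d) rewrite ≟ᶠ-≢ (punchIn t x) t (punchInᵢ≢i t x) = avoids-punched d

  isSurjective-punchIn : ∀ {k} (d : Vec (Fin ℓ) k) → isSurjective (t ∷ᵛ Vec.map (punchIn t) d) ≡ isSurjective d
  isSurjective-punchIn d = bool-ext
    (λ h → occurs⇒surjective d (λ v →
      trans (sym (occurs-punchIn v d))
            (trans (sym (cong (_∨ occurs (punchIn t v) (Vec.map (punchIn t) d))
                              (≟ᶠ-≢ t (punchIn t v) (λ eq → punchInᵢ≢i t v (sym eq)))))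
                   (surjective⇒occurs (t ∷ᵛ Vec.map (punchIn t) d) h (punchIn t v)))))
    (λ h → occurs⇒surjective (t ∷ᵛ Vec.map (punchIn t) d) (λ v → covered v (surjective⇒occurs d h)))
    where
    covered : ∀ v → (∀ w → occurs w d ≡ true) → (⌊ t ≟ᶠ v ⌋ ∨ occurs v (Vec.map (punchIn t) d)) ≡ true
    covered v all-occur with t ≟ᶠ v
    ... | yes _ = refl
    ... | no t≢v = trans (cong (λ z → occurs z (Vec.map (punchIn t) d)) (sym (punchIn-punchOut t≢v)))
                         (trans (occurs-punchIn (punchOut t≢v) d) (all-occur (punchOut t≢v)))

  -- punchIn t is injective, so the weight is unchanged.
  weight-punchIn : ∀ m (d : Vec (Fin ℓ) (suc m)) → weight m (colourAt (Vec.map (punchIn t) d)) ≡ weight m (colourAt d)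
  weight-punchIn zero (a ∷ᵛ []ᵛ) = refl
  weight-punchIn (suc m) (a ∷ᵛ b ∷ᵛ d) = cong₂ _*_ (cong (λ z → if z then 2 else 1) same-test) (weight-punchIn m (b ∷ᵛ d))
    where
    same-test : (toℕ (punchIn t a) ≡ᵇ toℕ (punchIn t b)) ≡ (toℕ a ≡ᵇ toℕ b)
    same-test = trans (sym (≟ᶠ-toℕ (punchIn t a) (punchIn t b))) (trans (≟-punchIn a b) (≟ᶠ-toℕ a b))

  first-differs : ∀ {k} (d : Vec (Fin ℓ) (suc k)) → (toℕ t ≡ᵇ colourAt (Vec.map (punchIn t) d) 0) ≡ false
  first-differs (a ∷ᵛ d) = trans (sym (≟ᶠ-toℕ t (punchIn t a))) (≟ᶠ-≢ t (punchIn t a) (λ eq → punchInᵢ≢i t a (sym eq)))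

sumL-allVecs-suc : ∀ ℓ k (h : Vec (Fin ℓ) (suc k) → ℕ) →
  sumL h (allVecs ℓ (suc k)) ≡ sumFin ℓ (λ t → sumL (λ c → h (t ∷ᵛ c)) (allVecs ℓ k))
sumL-allVecs-suc ℓ k h =
  trans (sumL-concatMap h (λ t → map (t ∷ᵛ_) (allVecs ℓ k)) (allFin ℓ))
        (trans (sumL-cong (allFin ℓ) (λ t → sumL-map h (t ∷ᵛ_) (allVecs ℓ k)))
               (sumL-allFin (λ t → sumL (λ c → h (t ∷ᵛ c)) (allVecs ℓ k))))

sumFin-skip : ∀ ℓ (t : Fin (suc ℓ)) (K : Fin (suc ℓ) → ℕ) →
  sumFin (suc ℓ) (λ v → if ⌊ v ≟ᶠ t ⌋ then 0 else K v) ≡ sumFin ℓ (λ w → K (punchIn t w))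
sumFin-skip ℓ fzero K = refl
sumFin-skip (suc ℓ) (fsuc t) K = cong (K fzero +_)
  (trans (sumFin-cong (suc ℓ) (λ v → cong (λ b → if b then 0 else K (fsuc v)) (≟-fsuc v t)))
         (sumFin-skip ℓ t (λ v → K (fsuc v))))
  where
  ≟-fsuc : ∀ {k} (v w : Fin k) → ⌊ fsuc v ≟ᶠ fsuc w ⌋ ≡ ⌊ v ≟ᶠ w ⌋
  ≟-fsuc v w = trans (≟ᶠ-toℕ (fsuc v) (fsuc w)) (sym (≟ᶠ-toℕ v w))

sumL-avoiding : ∀ {ℓ} k (t : Fin (suc ℓ)) (g : Vec (Fin (suc ℓ)) k → ℕ) →
  sumL (λ c → if occurs t c then 0 else g c) (allVecs (suc ℓ) k) ≡ sumL (λ d → g (Vec.map (punchIn t) d)) (allVecs ℓ k)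
sumL-avoiding zero t g = refl
sumL-avoiding {ℓ} (suc k) t g = begin
  sumL (λ c → if occurs t c then 0 else g c) (allVecs (suc ℓ) (suc k))
    ≡⟨ sumL-allVecs-suc (suc ℓ) k (λ c → if occurs t c then 0 else g c) ⟩
  sumFin (suc ℓ) (λ v → sumL (λ c → if ⌊ v ≟ᶠ t ⌋ ∨ occurs t c then 0 else g (v ∷ᵛ c)) (allVecs (suc ℓ) k))
    ≡⟨ sumFin-cong (suc ℓ) first-not-t ⟩
  sumFin (suc ℓ) (λ v → if ⌊ v ≟ᶠ t ⌋ then 0 else sumL (λ d → g (v ∷ᵛ Vec.map (punchIn t) d)) (allVecs ℓ k))
    ≡⟨ sumFin-skip ℓ t (λ v → sumL (λ d → g (v ∷ᵛ Vec.map (punchIn t) d)) (allVecs ℓ k)) ⟩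
  sumFin ℓ (λ w → sumL (λ d → g (punchIn t w ∷ᵛ Vec.map (punchIn t) d)) (allVecs ℓ k))
    ≡⟨ sym (sumL-allVecs-suc ℓ k (λ d → g (Vec.map (punchIn t) d))) ⟩
  sumL (λ d → g (Vec.map (punchIn t) d)) (allVecs ℓ (suc k))
    ∎
  where
  open ≡-Reasoning
  first-not-t : ∀ v → sumL (λ c → if ⌊ v ≟ᶠ t ⌋ ∨ occurs t c then 0 else g (v ∷ᵛ c)) (allVecs (suc ℓ) k)
                    ≡ (if ⌊ v ≟ᶠ t ⌋ then 0 else sumL (λ d → g (v ∷ᵛ Vec.map (punchIn t) d)) (allVecs ℓ k))
  first-not-t v with ⌊ v ≟ᶠ t ⌋
  ... | true = sumL-zero (allVecs (suc ℓ) k)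
  ... | false = sumL-avoiding k t (λ c → g (v ∷ᵛ c))

repeatFactor : ∀ {ℓ k} → Fin ℓ → Vec (Fin ℓ) (suc k) → ℕ
repeatFactor t c = if toℕ t ≡ᵇ colourAt c 0 then 2 else 1

-- Over all t, the factors add up to ℓ + 1: one colour repeats c₀.
repeatFactor-sum : ∀ ℓ b → b < ℓ → sumFin ℓ (λ t → if toℕ t ≡ᵇ b then 2 else 1) ≡ suc ℓ
repeatFactor-sum (suc ℓ) zero _ = cong (2 +_) (trans (sumFin-const ℓ 1) (*-identityʳ ℓ))
repeatFactor-sum (suc ℓ) (suc b) (s≤s b<ℓ) = cong (1 +_) (repeatFactor-sum ℓ b b<ℓ)

colourAt-< : ∀ {ℓ k} (c : Vec (Fin ℓ) (suc k)) → colourAt c 0 < ℓ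
colourAt-< (a ∷ᵛ c) = toℕ<n a

-- First colour already used by the rest: the rest is surjective, factor repeatFactor.
first-colour-repeated : ∀ m L →
  sumFin L (λ t → sumL (λ c → [ isSurjective c ]· (repeatFactor t c * weight m (colourAt c))) (allVecs L (suc m)))
  ≡ suc L * surjWeight m L
first-colour-repeated m L = begin
  sumFin L (λ t → sumL (λ c → summand t c) Vs)
    ≡⟨ sym (sumL-allFin (λ t → sumL (λ c → summand t c) Vs)) ⟩
  sumL (λ t → sumL (λ c → summand t c) Vs) (allFin L)
    ≡⟨ sumL-swap summand (allFin L) Vs ⟩
  sumL (λ c → sumL (λ t → summand t c) (allFin L)) Vs
    ≡⟨ sumL-cong Vs per-colouring ⟩
  sumL (λ c → suc L * w c) Vs
    ≡⟨ sumL-*ˡ w (suc L) Vs ⟩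
  suc L * surjWeight m L
    ∎
  where
  open ≡-Reasoning
  Vs = allVecs L (suc m)
  w : Vec (Fin L) (suc m) → ℕ
  w c = [ isSurjective c ]· weight m (colourAt c)
  summand : Fin L → Vec (Fin L) (suc m) → ℕ
  summand t c = [ isSurjective c ]· (repeatFactor t c * weight m (colourAt c))
  guard-* : ∀ b x y → [ b ]· (x * y) ≡ ([ b ]· y) * x
  guard-* true x y = *-comm x y
  guard-* false x y = refl
  per-colouring : ∀ c → sumL (λ t → summand t c) (allFin L) ≡ suc L * w c
  per-colouring c = begin
    sumL (λ t → summand t c) (allFin L)
      ≡⟨ sumL-cong (allFin L) (λ t → guard-* (isSurjective c) (repeatFactor t c) (weight m (colourAt c))) ⟩
    sumL (λ t → w c * repeatFactor t c) (allFin L)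
      ≡⟨ sumL-*ˡ (λ t → repeatFactor t c) (w c) (allFin L) ⟩
    w c * sumL (λ t → repeatFactor t c) (allFin L)
      ≡⟨ cong (w c *_) (trans (sumL-allFin (λ t → repeatFactor t c)) (repeatFactor-sum L (colourAt c 0) (colourAt-< c))) ⟩
    w c * suc L
      ≡⟨ *-comm (w c) (suc L) ⟩
    suc L * w c
      ∎

-- First colour t new: the rest is a surjective colouring by the other ℓ colours.
first-colour-fresh : ∀ m ℓ (t : Fin (suc ℓ)) →
  sumL (λ c → if occurs t c then 0 else [ isSurjective (t ∷ᵛ c) ]· weight (suc m) (colourAt (t ∷ᵛ c)))
       (allVecs (suc ℓ) (suc m))
  ≡ surjWeight m ℓ
first-colour-fresh m ℓ t = trans (sumL-avoiding (suc m) t _) (sumL-cong (allVecs ℓ (suc m)) punched)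
  where
  punched : ∀ d → [ isSurjective (t ∷ᵛ Vec.map (punchIn t) d) ]· weight (suc m) (colourAt (t ∷ᵛ Vec.map (punchIn t) d))
                ≡ [ isSurjective d ]· weight m (colourAt d)
  punched d rewrite isSurjective-punchIn t d | first-differs t d | weight-punchIn t m d =
    cong ([ isSurjective d ]·_) (+-identityʳ (weight m (colourAt d)))

surjWeight-suc : ∀ m ℓ → surjWeight (suc m) (suc ℓ) ≡ suc (suc ℓ) * surjWeight m (suc ℓ) + suc ℓ * surjWeight m ℓ
surjWeight-suc m ℓ = begin
  surjWeight (suc m) L
    ≡⟨ sumL-allVecs-suc L (suc m) h ⟩
  sumFin L (λ t → sumL (λ c → h (t ∷ᵛ c)) Vs)
    ≡⟨ sumFin-cong L (λ t → trans (sumL-cong Vs (λ c → surjective-cons t c (weight (suc m) (colourAt (t ∷ᵛ c)))))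
                                  (sumL-+ (λ c → [ isSurjective c ]· (repeatFactor t c * weight m (colourAt c)))
                                          (λ c → if occurs t c then 0 else h (t ∷ᵛ c)) Vs)) ⟩
  sumFin L (λ t → repeated t + fresh t)
    ≡⟨ sumFin-+ L repeated fresh ⟩
  sumFin L repeated + sumFin L fresh
    ≡⟨ cong₂ _+_ (first-colour-repeated m L) (trans (sumFin-cong L (first-colour-fresh m ℓ)) (sumFin-const L (surjWeight m ℓ))) ⟩
  suc L * surjWeight m L + L * surjWeight m ℓ
    ∎
  where
  open ≡-Reasoning
  L = suc ℓ
  Vs = allVecs L (suc m)
  h : Vec (Fin L) (suc (suc m)) → ℕ
  h c = [ isSurjective c ]· weight (suc m) (colourAt c)
  repeated fresh : Fin L → ℕ
  repeated t = sumL (λ c → [ isSurjective c ]· (repeatFactor t c * weight m (colourAt c))) Vs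
  fresh t = sumL (λ c → if occurs t c then 0 else h (t ∷ᵛ c)) Vs

surjWeight-single : ∀ ℓ → surjWeight 0 (suc (suc ℓ)) ≡ 0
surjWeight-single ℓ = trans (sumL-allVecs-suc (suc (suc ℓ)) 0 (λ c → [ isSurjective c ]· 1))
  (sumFin-zero (suc (suc ℓ)) _ (λ v → cong (λ b → [ b ]· 1 + 0) (not-surjective v)))
  where
  not-surjective : ∀ (v : Fin (suc (suc ℓ))) → isSurjective (v ∷ᵛ []ᵛ) ≡ false
  not-surjective v with isSurjective (v ∷ᵛ []ᵛ) in e
  ... | false = refl
  ... | true = ⊥-elim (misses v (surjective⇒occurs (v ∷ᵛ []ᵛ) e))
    where
    misses : ∀ (v : Fin (suc (suc ℓ))) → ¬ (∀ t → occurs t (v ∷ᵛ []ᵛ) ≡ true)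
    misses fzero h with h (fsuc fzero)
    ... | ()
    misses (fsuc _) h with h fzero
    ... | ()

surjWeight-vanishes : ∀ m ℓ → suc m < ℓ → surjWeight m ℓ ≡ 0
surjWeight-vanishes zero (suc zero) (s≤s ())
surjWeight-vanishes zero (suc (suc ℓ)) _ = surjWeight-single ℓ
surjWeight-vanishes (suc m) (suc ℓ) (s≤s m+1<ℓ) rewrite surjWeight-suc m ℓ
  | surjWeight-vanishes m (suc ℓ) (m<n⇒m<1+n m+1<ℓ) | surjWeight-vanishes m ℓ m+1<ℓ
  | *-zeroʳ (suc ℓ) = refl

-- (4) The alternating sum

module AlternatingSum where
  open import Data.Integer as ℤ using (ℤ; +_)
  import Data.Integer.Properties as ℤP
  import Data.Rational as ℚ
  open import Data.Rational using (ℚ; 0ℚ)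
  import Data.Rational.Properties as ℚP
  import Data.Rational.Unnormalised as U
  import Data.Rational.Unnormalised.Properties as UP
  open import Data.Rational.Solver using (module +-*-Solver)
  open +-*-Solver using (solve; _:=_; _:+_; _:*_; _:-_; :-_; con)

  ⟨_⟩ : ℕ → ℚ
  ⟨ a ⟩ = (+ a) ℚ./ 1

  ⟨_⟩ᶻ : ℤ → ℚ
  ⟨ i ⟩ᶻ = i ℚ./ 1

  coeff : ℕ → ℚ
  coeff k = sign k ℚ./ suc k

  /-as-ℚᵘ : ∀ i d → ℚ.toℚᵘ (i ℚ./ suc d) U.≃ U.mkℚᵘ i d
  /-as-ℚᵘ i d = ℚP.toℚᵘ-fromℚᵘ (U.mkℚᵘ i d)

  ⟨⟩-+ : ∀ a b → ⟨ a + b ⟩ ≡ ⟨ a ⟩ ℚ.+ ⟨ b ⟩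
  ⟨⟩-+ a b = ℚP.toℚᵘ-injective
    (UP.≃-trans (/-as-ℚᵘ (+ (a + b)) 0)
    (UP.≃-trans (U.*≡* cross)
    (UP.≃-sym (UP.≃-trans (ℚP.toℚᵘ-homo-+ ⟨ a ⟩ ⟨ b ⟩) (UP.+-cong (/-as-ℚᵘ (+ a) 0) (/-as-ℚᵘ (+ b) 0))))))
    where
    cross : + (a + b) ℤ.* + 1 ≡ (+ a ℤ.* + 1 ℤ.+ + b ℤ.* + 1) ℤ.* + 1
    cross rewrite ℤP.*-identityʳ (+ a) | ℤP.*-identityʳ (+ b) | ℤP.*-identityʳ (+ a ℤ.+ + b) = ℤP.pos-+ a b

  ⟨⟩-* : ∀ a b → ⟨ a * b ⟩ ≡ ⟨ a ⟩ ℚ.* ⟨ b ⟩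
  ⟨⟩-* a b = ℚP.toℚᵘ-injective
    (UP.≃-trans (/-as-ℚᵘ (+ (a * b)) 0)
    (UP.≃-trans (U.*≡* cross)
    (UP.≃-sym (UP.≃-trans (ℚP.toℚᵘ-homo-* ⟨ a ⟩ ⟨ b ⟩) (UP.*-cong (/-as-ℚᵘ (+ a) 0) (/-as-ℚᵘ (+ b) 0))))))
    where
    cross : + (a * b) ℤ.* + 1 ≡ (+ a ℤ.* + b) ℤ.* + 1
    cross rewrite ℤP.*-identityʳ (+ a ℤ.* + b) | ℤP.*-identityʳ (+ (a * b)) = ℤP.pos-* a b

  coeff-cancel : ∀ k → coeff k ℚ.* ⟨ suc k ⟩ ≡ ⟨ sign k ⟩ᶻ
  coeff-cancel k = ℚP.toℚᵘ-injective
    (UP.≃-trans (ℚP.toℚᵘ-homo-* (coeff k) ⟨ suc k ⟩)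
    (UP.≃-trans (UP.*-cong (/-as-ℚᵘ (sign k) k) (/-as-ℚᵘ (+ suc k) 0))
    (UP.≃-trans (U.*≡* cross) (UP.≃-sym (/-as-ℚᵘ (sign k) 0)))))
    where
    cross : (sign k ℤ.* + suc k) ℤ.* + 1 ≡ sign k ℤ.* + suc (k * 1)
    cross rewrite *-identityʳ k = ℤP.*-identityʳ (sign k ℤ.* + suc k)

  sign-suc : ∀ k → ⟨ sign (suc k) ⟩ᶻ ≡ ℚ.- ⟨ sign k ⟩ᶻ
  sign-suc zero = refl
  sign-suc (suc zero) = refl
  sign-suc (suc (suc k)) = sign-suc k

  sumQ : ℕ → (ℕ → ℚ) → ℚ
  sumQ zero F = 0ℚ
  sumQ (suc M) F = F 0 ℚ.+ sumQ M (λ k → F (suc k))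

  sumQ-cong : ∀ M {F G : ℕ → ℚ} → (∀ k → F k ≡ G k) → sumQ M F ≡ sumQ M G
  sumQ-cong zero e = refl
  sumQ-cong (suc M) e = cong₂ ℚ._+_ (e 0) (sumQ-cong M (λ k → e (suc k)))

  +-interchangeℚ : ∀ a b c d → (a ℚ.+ b) ℚ.+ (c ℚ.+ d) ≡ (a ℚ.+ c) ℚ.+ (b ℚ.+ d)
  +-interchangeℚ = solve 4 (λ a b c d → (a :+ b) :+ (c :+ d) := (a :+ c) :+ (b :+ d)) refl

  sumQ-+ : ∀ M (F G : ℕ → ℚ) → sumQ M (λ k → F k ℚ.+ G k) ≡ sumQ M F ℚ.+ sumQ M G
  sumQ-+ zero F G = refl
  sumQ-+ (suc M) F G =
    trans (cong (F 0 ℚ.+ G 0 ℚ.+_) (sumQ-+ M (λ k → F (suc k)) (λ k → G (suc k)))) (+-interchangeℚ (F 0) (G 0) _ _)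

  sumQ-last : ∀ M (F : ℕ → ℚ) → sumQ (suc M) F ≡ sumQ M F ℚ.+ F M
  sumQ-last zero F = trans (ℚP.+-identityʳ (F 0)) (sym (ℚP.+-identityˡ (F 0)))
  sumQ-last (suc M) F = trans (cong (F 0 ℚ.+_) (sumQ-last M (λ k → F (suc k)))) (sym (ℚP.+-assoc (F 0) _ (F (suc M))))

  telescope : ∀ M (t : ℕ → ℚ) → sumQ M (λ k → t k ℚ.- t (suc k)) ≡ t 0 ℚ.- t M
  telescope zero t = sym (ℚP.+-inverseʳ (t 0))
  telescope (suc M) t =
    trans (sumQ-last M (λ k → t k ℚ.- t (suc k)))
          (trans (cong (ℚ._+ (t M ℚ.- t (suc M))) (telescope M t)) (chain (t 0) (t M) (t (suc M))))
    where
    chain : ∀ a b c → (a ℚ.- b) ℚ.+ (b ℚ.- c) ≡ a ℚ.- c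
    chain = solve 3 (λ a b c → (a :- b) :+ (b :- c) := a :- c) refl

  module _ {A : Set} where

    sumℚ-cong : {F G : A → ℚ} (xs : List A) → (∀ x → F x ≡ G x) → sumℚ (map F xs) ≡ sumℚ (map G xs)
    sumℚ-cong [] e = refl
    sumℚ-cong (x ∷ xs) e = cong₂ ℚ._+_ (e x) (sumℚ-cong xs e)

    sumℚ-zero : (xs : List A) → sumℚ (map (λ _ → 0ℚ) xs) ≡ 0ℚ
    sumℚ-zero [] = refl
    sumℚ-zero (x ∷ xs) = trans (cong (0ℚ ℚ.+_) (sumℚ-zero xs)) (ℚP.+-identityˡ 0ℚ)

    sumℚ-+ : (F G : A → ℚ) (xs : List A) → sumℚ (map (λ x → F x ℚ.+ G x) xs) ≡ sumℚ (map F xs) ℚ.+ sumℚ (map G xs)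
    sumℚ-+ F G [] = refl
    sumℚ-+ F G (x ∷ xs) = trans (cong (F x ℚ.+ G x ℚ.+_) (sumℚ-+ F G xs)) (+-interchangeℚ (F x) (G x) _ _)

    sumℚ-sumQ : (M : ℕ) (F : A → ℕ → ℚ) (xs : List A) →
      sumℚ (map (λ x → sumQ M (F x)) xs) ≡ sumQ M (λ k → sumℚ (map (λ x → F x k) xs))
    sumℚ-sumQ zero F xs = sumℚ-zero xs
    sumℚ-sumQ (suc M) F xs =
      trans (sumℚ-+ (λ x → F x 0) (λ x → sumQ M (λ k → F x (suc k))) xs)
            (cong (sumℚ (map (λ x → F x 0) xs) ℚ.+_) (sumℚ-sumQ M (λ x k → F x (suc k)) xs))

    sumℚ-*ˡ : (q : ℚ) (F : A → ℚ) (xs : List A) → sumℚ (map (λ x → q ℚ.* F x) xs) ≡ q ℚ.* sumℚ (map F xs)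
    sumℚ-*ˡ q F [] = sym (ℚP.*-zeroʳ q)
    sumℚ-*ˡ q F (x ∷ xs) = trans (cong (q ℚ.* F x ℚ.+_) (sumℚ-*ˡ q F xs)) (sym (ℚP.*-distribˡ-+ q (F x) _))

    sumℚ-⟨⟩ : (g : A → ℕ) (xs : List A) → sumℚ (map (λ x → ⟨ g x ⟩) xs) ≡ ⟨ sumL g xs ⟩
    sumℚ-⟨⟩ g [] = refl
    sumℚ-⟨⟩ g (x ∷ xs) = trans (cong (⟨ g x ⟩ ℚ.+_) (sumℚ-⟨⟩ g xs)) (sym (⟨⟩-+ (g x) (sumL g xs)))

  sumℚ-map-map : {A B : Set} (F : B → ℚ) (G : A → B) (xs : List A) → sumℚ (map F (map G xs)) ≡ sumℚ (map (λ x → F (G x)) xs)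
  sumℚ-map-map F G [] = refl
  sumℚ-map-map F G (x ∷ xs) = cong (F (G x) ℚ.+_) (sumℚ-map-map F G xs)

  sumℚ-upTo : ∀ M (F : ℕ → ℚ) → sumℚ (map F (upTo M)) ≡ sumQ M F
  sumℚ-upTo M F = go M F (λ k → k)
    where
    go : ∀ M (F : ℕ → ℚ) (g : ℕ → ℕ) → sumℚ (map F (applyUpTo g M)) ≡ sumQ M (λ k → F (g k))
    go zero F g = refl
    go (suc M) F g = cong (F (g 0) ℚ.+_) (go M F (λ k → g (suc k)))

  alternating : ℕ → ℚ
  alternating m = sumQ (suc m) (λ k → coeff k ℚ.* ⟨ surjWeight m (suc k) ⟩)

  -- The signed terms (-1)^k · h(m,k) whose differences make up the change from m to m+1.
  signed : ℕ → ℕ → ℚ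
  signed m k = ⟨ sign k ⟩ᶻ ℚ.* ⟨ surjWeight m k ⟩

  recurrence-term : ∀ m k → coeff k ℚ.* ⟨ surjWeight (suc m) (suc k) ⟩
                  ≡ coeff k ℚ.* ⟨ surjWeight m (suc k) ⟩ ℚ.+ (signed m k ℚ.- signed m (suc k))
  recurrence-term m k = begin
    q ℚ.* ⟨ surjWeight (suc m) (suc k) ⟩
      ≡⟨ cong (λ z → q ℚ.* ⟨ z ⟩) (surjWeight-suc m k) ⟩
    q ℚ.* ⟨ suc (suc k) * a + suc k * b ⟩
      ≡⟨ cong (q ℚ.*_) (trans (⟨⟩-+ (suc (suc k) * a) (suc k * b))
                              (cong₂ ℚ._+_ (trans (⟨⟩-* (suc (suc k)) a) (cong (ℚ._* A) (⟨⟩-+ 1 (suc k))))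
                                           (⟨⟩-* (suc k) b))) ⟩
    q ℚ.* ((ℚ.1ℚ ℚ.+ K) ℚ.* A ℚ.+ K ℚ.* B)
      ≡⟨ solve 4 (λ q K A B → q :* ((con ℚ.1ℚ :+ K) :* A :+ K :* B) := q :* A :+ (q :* K :* B :- (:- (q :* K)) :* A))
               refl q K A B ⟩
    q ℚ.* A ℚ.+ (q ℚ.* K ℚ.* B ℚ.- (ℚ.- (q ℚ.* K)) ℚ.* A)
      ≡⟨ cong (λ s → q ℚ.* A ℚ.+ (s ℚ.* B ℚ.- (ℚ.- s) ℚ.* A)) (coeff-cancel k) ⟩
    q ℚ.* A ℚ.+ (signed m k ℚ.- (ℚ.- ⟨ sign k ⟩ᶻ) ℚ.* A)
      ≡⟨ cong (λ s → q ℚ.* A ℚ.+ (signed m k ℚ.- s ℚ.* A)) (sym (sign-suc k)) ⟩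
    q ℚ.* A ℚ.+ (signed m k ℚ.- signed m (suc k))
      ∎
    where
    open ≡-Reasoning
    q = coeff k
    a = surjWeight m (suc k)
    b = surjWeight m k
    A = ⟨ a ⟩
    B = ⟨ b ⟩
    K = ⟨ suc k ⟩

  -- The alternating sum does not depend on m: the extra terms telescope away.
  alternating-step : ∀ m → alternating (suc m) ≡ alternating m
  alternating-step m = begin
    alternating (suc m)
      ≡⟨ sumQ-cong (suc (suc m)) (recurrence-term m) ⟩
    sumQ (suc (suc m)) (λ k → P k ℚ.+ (signed m k ℚ.- signed m (suc k)))
      ≡⟨ sumQ-+ (suc (suc m)) P (λ k → signed m k ℚ.- signed m (suc k)) ⟩
    sumQ (suc (suc m)) P ℚ.+ sumQ (suc (suc m)) (λ k → signed m k ℚ.- signed m (suc k))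
      ≡⟨ cong₂ ℚ._+_ (sumQ-last (suc m) P) (telescope (suc (suc m)) (signed m)) ⟩
    (alternating m ℚ.+ P (suc m)) ℚ.+ (signed m 0 ℚ.- signed m (suc (suc m)))
      ≡⟨ cong₂ (λ x y → (alternating m ℚ.+ x) ℚ.+ (signed m 0 ℚ.- y)) last-vanishes top-vanishes ⟩
    (alternating m ℚ.+ 0ℚ) ℚ.+ (0ℚ ℚ.- 0ℚ)
      ≡⟨ trans (ℚP.+-identityʳ (alternating m ℚ.+ 0ℚ)) (ℚP.+-identityʳ (alternating m)) ⟩
    alternating m
      ∎
    where
    open ≡-Reasoning
    P : ℕ → ℚ
    P k = coeff k ℚ.* ⟨ surjWeight m (suc k) ⟩
    too-many : surjWeight m (suc (suc m)) ≡ 0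
    too-many = surjWeight-vanishes m (suc (suc m)) (n<1+n (suc m))
    last-vanishes : P (suc m) ≡ 0ℚ
    last-vanishes = trans (cong (λ z → coeff (suc m) ℚ.* ⟨ z ⟩) too-many) (ℚP.*-zeroʳ (coeff (suc m)))
    top-vanishes : signed m (suc (suc m)) ≡ 0ℚ
    top-vanishes = trans (cong (λ z → ⟨ sign (suc (suc m)) ⟩ᶻ ℚ.* ⟨ z ⟩) too-many) (ℚP.*-zeroʳ ⟨ sign (suc (suc m)) ⟩ᶻ)

  alternating≡1 : ∀ m → alternating m ≡ ℚ.1ℚ
  alternating≡1 zero = refl
  alternating≡1 (suc m) = trans (alternating-step m) (alternating≡1 m)

  traceR≡alternating : ∀ n → traceR n ≡ alternating n
  traceR≡alternating n = begin
    traceR n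
      ≡⟨ sumℚ-map-map (λ D → R D D) webDiagram (allBoolVecs n) ⟩
    sumℚ (map (λ s → R (webDiagram s) (webDiagram s)) (allBoolVecs n))
      ≡⟨ sumℚ-cong (allBoolVecs n) diagonal ⟩
    sumℚ (map (λ s → sumQ (suc n) (λ k → coeff k ℚ.* ⟨ f (webDiagram s) (webDiagram s) (suc k) ⟩)) (allBoolVecs n))
      ≡⟨ sumℚ-sumQ (suc n) (λ s k → coeff k ℚ.* ⟨ f (webDiagram s) (webDiagram s) (suc k) ⟩) (allBoolVecs n) ⟩
    sumQ (suc n) (λ k → sumℚ (map (λ s → coeff k ℚ.* ⟨ f (webDiagram s) (webDiagram s) (suc k) ⟩) (allBoolVecs n)))
      ≡⟨ sumQ-cong (suc n) over-W ⟩
    alternating n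
      ∎
    where
    open ≡-Reasoning
    diagonal : ∀ s → R (webDiagram s) (webDiagram s) ≡ sumQ (suc n) (λ k → coeff k ℚ.* ⟨ f (webDiagram s) (webDiagram s) (suc k) ⟩)
    diagonal s = trans (cong (λ L → sumℚ (map (term (webDiagram s) (webDiagram s)) (upTo L)))
                             (length-applyUpTo (chainEdge s) (suc n)))
                       (sumℚ-upTo (suc n) (term (webDiagram s) (webDiagram s)))
    over-W : ∀ k → sumℚ (map (λ s → coeff k ℚ.* ⟨ f (webDiagram s) (webDiagram s) (suc k) ⟩) (allBoolVecs n))
                 ≡ coeff k ℚ.* ⟨ surjWeight n (suc k) ⟩
    over-W k = trans (sumℚ-*ˡ (coeff k) (λ s → ⟨ f (webDiagram s) (webDiagram s) (suc k) ⟩) (allBoolVecs n))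
                     (cong (coeff k ℚ.*_) (trans (sumℚ-⟨⟩ (λ s → f (webDiagram s) (webDiagram s) (suc k)) (allBoolVecs n))
                                                 (cong ⟨_⟩ (Σ-f-web n (suc k)))))

-- Theorem 7.4 (the argument needs no lower bound on n).
theorem7p4 : (n : ℕ) → n ≥ 1 → traceR n ≡ 1ℚ
theorem7p4 n _ = trans (AlternatingSum.traceR≡alternating n) (AlternatingSum.alternating≡1 n)
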